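{- Let $p$ be an ideal prime for a strong divisibility sequence $C$ (with associated integer $s(p)\ge1$), and let $k\ge2$ be an integer. For any integer $n\ge0$, write $n=\alpha(p)n'+r$ with $0\le r<\alpha(p)$ and $n'\in\mathbb N$. Then \[ \sum_{\substack{\mathbf m\in\mathbb N^k\\ \operatorname{tot}\mathbf m=n}}x^{\nu_p\left(\binom{n}{m_1,\dots,m_k}_C\right)}=\sum_{\lambda=0}^{k-1}u_{p,k,C,\lambda}(r)\,T_{p,k,\lambda}(n',x), \] where \[ u_{p,k,C,\lambda}(r)=x^{(s(p)-1)\lambda}\sum_{j=0}^{\lambda}(-1)^j\binom{k}{j}\binom{r+(\lambda-j)\alpha(p)+k-1}{k-1}. \]
   Context: A strong divisibility sequence is a sequence $C=C_1,C_2,\dots$ of nonzero integers with $\gcd(C_n,C_m)=C_{\gcd(n,m)}$ for all positive $n,m$. The $C$-orial is $0!_C=1$, $n!_C=C_nC_{n-1}\cdots C_1$ for $n\ge1$. For $\mathbf m=(m_1,\dots,m_k)\in\mathbb N^k$ ($\mathbb N$ includes $0$) write $\operatorname{tot}\mathbf m=m_1+\cdots+m_k$; for $\operatorname{tot}\mathbf m=n$, $\binom{n}{m_1,\dots,m_k}_C=\frac{n!_C}{m_1!_C\cdots m_k!_C}$ and $\binom{n}{m_1,\dots,m_k}=\frac{n!}{m_1!\cdots m_k!}$. $\nu_p$ is the $p$-adic valuation. Let $T_{p,k}(n,x)=\sum_{\mathbf m\in\mathbb N^k,\ \operatorname{tot}\mathbf m=n}x^{\nu_p(\binom{n}{m_1,\dots,m_k})}$,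 and for $0\le\lambda\le k-1$ let $T_{p,k,\lambda}(n,x)=0$ if $0\le n\le\lambda-1$ and $T_{p,k,\lambda}(n,x)=x^{\nu_p\left(\frac{n!}{(n-\lambda)!}\right)+\lambda}T_{p,k}(n-\lambda,x)$ if $n\ge\lambda$. The rank of apparition $\alpha(m)$ is the least index $j\ge1$ with $m\mid C_j$ (if it exists). When $\alpha(p^k)$ exists for all $k\ge1$, set $a_k(p)=\alpha(p^k)/\alpha(p^{k-1})$ for $k\ge2$. The prime $p$ is ideal for $C$ if $\alpha(p^k)$ exists for all $k\ge1$ and there is an integer $s(p)\ge1$ with $a_k(p)=1$ for $2\le k\le s(p)$ and $a_k(p)=p$ for $k>s(p)$. -}

module Defs where

open import Data.Nat as ℕ using (ℕ; zero; suc; _+_; _*_; _∸_; _≤_; _<_; _!)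
open import Data.Nat.Properties using (_≟_)
open import Data.Nat.Divisibility using (_∣?_)
open import Data.Nat.DivMod using (_/_)
open import Data.Nat.Combinatorics using () renaming (_C_ to binom)
open import Data.Nat.Primality using (Prime)
open import Data.Integer as ℤ using (ℤ; +_; ∣_∣)
import Data.Integer.Divisibility as ℤD
open import Data.Integer.GCD as ℤG using ()
open import Data.Nat.GCD using (gcd)
open import Data.List using (List; []; _∷_; map; concatMap; upTo; foldr)
open import Data.Vec using (Vec; []; _∷_)
open import Data.Product using (Σ; _×_; ∃)
open import Relation.Nullary using (¬_; yes; no)
open import Relation.Binary.PropositionalEquality using (_≡_)

-- p-adic valuation on ℕ (ν p 0 = 0 by convention; only used on nonzero
-- arguments).  Fuel n suffices since n / p < n for p ≥ 2, n ≥ 1.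

νAux : ℕ → ℕ → ℕ → ℕ
νAux zero _ _ = 0
νAux (suc f) zero n = 0
νAux (suc f) (suc zero) n = 0
νAux (suc f) (suc (suc q)) n with n ≟ 0 | suc (suc q) ∣? n
... | no _ | yes _ = suc (νAux f (suc (suc q)) (n / suc (suc q)))
... | _    | _     = 0

ν : ℕ → ℕ → ℕ
ν p n = νAux n p n

νℤ : ℕ → ℤ → ℕ
νℤ p z = ν p ∣ z ∣

sumℕ : List ℕ → ℕ
sumℕ = foldr _+_ 0

sumℤ : List ℤ → ℤ
sumℤ = foldr ℤ._+_ (+ 0)

vsum : ∀ {k} → Vec ℕ k → ℕ
vsum [] = 0
vsum (m ∷ ms) = m + vsum ms

vmap : ∀ {k} → (ℕ → ℕ) → Vec ℕ k → List ℕ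
vmap f [] = []
vmap f (m ∷ ms) = f m ∷ vmap f ms

compositions : (k n : ℕ) → List (Vec ℕ k)
compositions zero zero = [] ∷ []
compositions zero (suc n) = []
compositions (suc k) n =
  concatMap (λ i → map (i ∷_) (compositions k (n ∸ i))) (upTo (suc n))

-- strong divisibility sequences (C n meaningful for n ≥ 1; C 0 unused)

IsStrongDivSeq : (ℕ → ℤ) → Set
IsStrongDivSeq C =
  (∀ n → 1 ≤ n → ¬ (C n ≡ + 0)) ×
  (∀ n m → 1 ≤ n → 1 ≤ m → ℤG.gcd (C n) (C m) ≡ C (gcd n m))

corial : (ℕ → ℤ) → ℕ → ℤ
corial C zero = + 1
corial C (suc n) = C (suc n) ℤ.* corial C n

νMultiC : (ℕ → ℤ) → ℕ → ∀ {k} → Vec ℕ k → ℕ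
νMultiC C p ms =
  νℤ p (corial C (vsum ms)) ∸ sumℕ (vmap (λ m → νℤ p (corial C m)) ms)

νMulti : ℕ → ∀ {k} → Vec ℕ k → ℕ
νMulti p ms = ν p (vsum ms !) ∸ sumℕ (vmap (λ m → ν p (m !)) ms)

T : ℕ → ℕ → ℕ → ℤ → ℤ
T p k n x = sumℤ (map (λ ms → x ℤ.^ νMulti p ms) (compositions k n))

Tλ : ℕ → ℕ → ℕ → ℕ → ℤ → ℤ
Tλ p k l n x with l ℕ.≤? n
... | no _ = + 0
... | yes _ = x ℤ.^ ((ν p (n !) ∸ ν p ((n ∸ l) !)) + l) ℤ.* T p k (n ∸ l) x

LHS : (ℕ → ℤ) → ℕ → ℕ → ℕ → ℤ → ℤ
LHS C p k n x = sumℤ (map (λ ms → x ℤ.^ νMultiC C p ms) (compositions k n))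

-- u_{p,k,C,λ}(r), with a = α(p), s = s(p)
u : (a s k l r : ℕ) → ℤ → ℤ
u a s k l r x =
  x ℤ.^ ((s ∸ 1) * l) ℤ.*
  sumℤ (map (λ j → (ℤ.- (+ 1)) ℤ.^ j ℤ.* (+ binom k j) ℤ.*
                   (+ binom (r + (l ∸ j) * a + k ∸ 1) (k ∸ 1)))
            (upTo (suc l)))

IsRankOfApparition : (ℕ → ℤ) → ℕ → ℕ → Set
IsRankOfApparition C m j =
  1 ≤ j × (+ m) ℤD.∣ C j × (∀ i → 1 ≤ i → i < j → ¬ ((+ m) ℤD.∣ C i))

IsApparitionOfPowers : (ℕ → ℤ) → ℕ → (ℕ → ℕ) → Set
IsApparitionOfPowers C p α = ∀ e → 1 ≤ e → IsRankOfApparition C (p ℕ.^ e) (α e)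

-- p ideal for C, with ranks α e = α(p^e) and associated integer s
-- (a_e = α(p^e)/α(p^{e-1}) stated multiplicatively)
IsIdealWith : (ℕ → ℤ) → ℕ → (ℕ → ℕ) → ℕ → Set
IsIdealWith C p α s =
  IsApparitionOfPowers C p α × 1 ≤ s ×
  (∀ e → 2 ≤ e → e ≤ s → α e ≡ α (e ∸ 1)) ×
  (∀ e → s < e → α e ≡ p * α (e ∸ 1))

-- Write a = α(p). For a strong divisibility sequence, p^e ∣ C_m exactly when α(p^e) ∣ m, and
-- for an ideal prime α(p^(s+j)) = p^j a; hence ν_p(C_m) = 0 unless a ∣ m, ν_p(C_(a q)) = s + ν_p(q),
-- and ν_p(m!_C) = s q + ν_p(q!) depends only on the quotient q = ⌊m / a⌋.  Grouping the
-- compositions m of n = a n′ + r by their vector of quotients q, of total n′ - l, the exponent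
-- ν_p of the C-multinomial becomes (s - 1) l + (ν_p(n′! / (n′ - l)!) + l) + ν_p(multinomial of q),
-- and each q is hit by as many m as there are compositions of r + a l into k parts below a.
-- Inclusion-exclusion counts these as Σ_j (-1)^j C(k, j) C(r + (l - j) a + k - 1, k - 1), and
-- there are none once l ≥ k, since then r + a l exceeds k (a - 1).

module Submission where

open import Defs
open import Data.Nat as ℕ using (ℕ; zero; suc; _≤_; _<_; _∸_; z≤n; s≤s; _≤?_; _!; NonZero; NonTrivial)
import Data.Nat.Properties as ℕP
open import Data.Nat.Primality using (Prime; prime⇒nonTrivial)
open import Data.Integer as ℤ using (ℤ; 0ℤ; 1ℤ)
import Data.Integer.Properties as ℤP
open import Data.Integer.Tactic.RingSolver using (solve-∀)
open import Data.Nat.Tactic.RingSolver using () renaming (solve-∀ to ℕ-solve-∀)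
open import Data.List using (List; []; _∷_; _++_; map; concatMap; applyUpTo; upTo)
open import Data.List.Properties using (map-++; map-∘)
open import Data.Vec using (Vec; []; _∷_)
open import Data.Product using (∃-syntax; _×_; _,_; proj₁; proj₂)
open import Data.Sum using (inj₁; inj₂)
open import Function using (_∘_; id)
open import Relation.Nullary using (¬_; yes; no; contradiction)
open import Relation.Binary.PropositionalEquality

module FiniteSums where
  open import Data.Integer using (_+_; _*_; _-_)

  ∑ : ℕ → (ℕ → ℤ) → ℤ
  ∑ zero    f = 0ℤ
  ∑ (suc n) f = ∑ n f + f n

  syntax ∑ n (λ i → e) = ∑[ i < n ] e

  ∑-cong : ∀ n {f g : ℕ → ℤ} → (∀ i → i < n → f i ≡ g i) → ∑ n f ≡ ∑ n g
  ∑-cong zero    f≡g = refl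
  ∑-cong (suc n) f≡g = cong₂ _+_ (∑-cong n (λ i i<n → f≡g i (ℕP.m<n⇒m<1+n i<n))) (f≡g n ℕP.≤-refl)

  ∑-zero : ∀ n {f : ℕ → ℤ} → (∀ i → i < n → f i ≡ 0ℤ) → ∑ n f ≡ 0ℤ
  ∑-zero zero    f≡0 = refl
  ∑-zero (suc n) f≡0 = cong₂ _+_ (∑-zero n (λ i i<n → f≡0 i (ℕP.m<n⇒m<1+n i<n))) (f≡0 n ℕP.≤-refl)

  ∑-distrib-+ : ∀ n (f g : ℕ → ℤ) → ∑[ i < n ] (f i + g i) ≡ ∑ n f + ∑ n g
  ∑-distrib-+ zero    f g = refl
  ∑-distrib-+ (suc n) f g rewrite ∑-distrib-+ n f g = swap (∑ n f) (∑ n g) (f n) (g n)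
    where swap : ∀ a b c d → a + b + (c + d) ≡ a + c + (b + d)
          swap = solve-∀

  *-distribˡ-∑ : ∀ n c (f : ℕ → ℤ) → c * ∑ n f ≡ ∑[ i < n ] (c * f i)
  *-distribˡ-∑ zero    c f = ℤP.*-zeroʳ c
  *-distribˡ-∑ (suc n) c f rewrite sym (*-distribˡ-∑ n c f) = ℤP.*-distribˡ-+ c (∑ n f) (f n)

  *-distribʳ-∑ : ∀ n c (f : ℕ → ℤ) → ∑ n f * c ≡ ∑[ i < n ] (f i * c)
  *-distribʳ-∑ n c f = begin
    ∑ n f * c            ≡⟨ ℤP.*-comm (∑ n f) c ⟩
    c * ∑ n f            ≡⟨ *-distribˡ-∑ n c f ⟩
    ∑[ i < n ] (c * f i) ≡⟨ ∑-cong n (λ i _ → ℤP.*-comm c (f i)) ⟩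
    ∑[ i < n ] (f i * c) ∎
    where open ≡-Reasoning

  ∑-+ : ∀ m n (f : ℕ → ℤ) → ∑ (m ℕ.+ n) f ≡ ∑ m f + ∑[ i < n ] f (m ℕ.+ i)
  ∑-+ m zero    f rewrite ℕP.+-identityʳ m = sym (ℤP.+-identityʳ (∑ m f))
  ∑-+ m (suc n) f rewrite ℕP.+-suc m n | ∑-+ m n f =
    ℤP.+-assoc (∑ m f) (∑[ i < n ] f (m ℕ.+ i)) (f (m ℕ.+ n))

  ∑-sucˡ : ∀ n (f : ℕ → ℤ) → ∑ (suc n) f ≡ f 0 + ∑[ i < n ] f (suc i)
  ∑-sucˡ n f = trans (∑-+ 1 n f) (cong (_+ ∑[ i < n ] f (suc i)) (ℤP.+-identityˡ (f 0)))

  ∑-comm : ∀ n m (f : ℕ → ℕ → ℤ) → ∑[ i < n ] ∑ m (f i) ≡ ∑[ j < m ] ∑[ i < n ] f i j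
  ∑-comm zero    m f = sym (∑-zero m (λ _ _ → refl))
  ∑-comm (suc n) m f rewrite ∑-comm n m f = sym (∑-distrib-+ m (λ j → ∑[ i < n ] f i j) (f n))

  ∑-truncate : ∀ {m n} (f : ℕ → ℤ) → m ≤ n → (∀ i → m ≤ i → i < n → f i ≡ 0ℤ) → ∑ n f ≡ ∑ m f
  ∑-truncate {m} {n} f m≤n tail≡0 = begin
    ∑ n f                                      ≡⟨ cong (λ l → ∑ l f) (sym (ℕP.m+[n∸m]≡n m≤n)) ⟩
    ∑ (m ℕ.+ (n ∸ m)) f                        ≡⟨ ∑-+ m (n ∸ m) f ⟩
    ∑ m f + ∑[ i < n ∸ m ] f (m ℕ.+ i)         ≡⟨ cong (∑ m f +_) (∑-zero (n ∸ m) tail) ⟩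
    ∑ m f + 0ℤ                                 ≡⟨ ℤP.+-identityʳ (∑ m f) ⟩
    ∑ m f                                      ∎
    where
    open ≡-Reasoning
    tail : ∀ i → i < n ∸ m → f (m ℕ.+ i) ≡ 0ℤ
    tail i i<n∸m = tail≡0 (m ℕ.+ i) (ℕP.m≤m+n m i)
      (subst (m ℕ.+ i <_) (ℕP.m+[n∸m]≡n m≤n) (ℕP.+-monoʳ-< m i<n∸m))

  ∑-cong-support : ∀ m n {f g : ℕ → ℤ} → (∀ i → n ≤ i → i < m → f i ≡ 0ℤ) → (∀ i → m ≤ i → i < n → g i ≡ 0ℤ) →
                   (∀ i → i < m → i < n → f i ≡ g i) → ∑ m f ≡ ∑ n g
  ∑-cong-support m n {f} {g} f≡0 g≡0 f≡g with ℕP.≤-total m n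
  ... | inj₁ m≤n = trans (∑-cong m (λ i i<m → f≡g i i<m (ℕP.<-≤-trans i<m m≤n))) (sym (∑-truncate g m≤n g≡0))
  ... | inj₂ n≤m = trans (∑-truncate f n≤m f≡0) (∑-cong n (λ i i<n → f≡g i (ℕP.<-≤-trans i<n n≤m) i<n))

  ∑-reverse : ∀ n (f : ℕ → ℤ) → ∑ n f ≡ ∑[ i < n ] f (n ∸ suc i)
  ∑-reverse zero    f = refl
  ∑-reverse (suc n) f = begin
    ∑ n f + f n                               ≡⟨ cong (_+ f n) (∑-reverse n f) ⟩
    ∑[ i < n ] f (n ∸ suc i) + f n            ≡⟨ ℤP.+-comm (∑[ i < n ] f (n ∸ suc i)) (f n) ⟩
    f n + ∑[ i < n ] f (n ∸ suc i)            ≡⟨ ∑-sucˡ n (λ i → f (suc n ∸ suc i)) ⟨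
    ∑[ i < suc n ] f (suc n ∸ suc i)          ∎
    where open ≡-Reasoning

  ∑-blocks : ∀ a N (f : ℕ → ℤ) → ∑ (a ℕ.* N) f ≡ ∑[ q < N ] ∑[ t < a ] f (a ℕ.* q ℕ.+ t)
  ∑-blocks a zero    f rewrite ℕP.*-zeroʳ a = refl
  ∑-blocks a (suc N) f
    rewrite ℕP.*-suc a N | ℕP.+-comm a (a ℕ.* N) | ∑-+ (a ℕ.* N) a f | ∑-blocks a N f = refl

  ∑-triangle : ∀ N (g : ℕ → ℕ → ℤ) →
               ∑[ Q < N ] ∑[ q < suc Q ] g q (Q ∸ q) ≡ ∑[ q < N ] ∑ (N ∸ q) (g q)
  ∑-triangle zero    g = refl
  ∑-triangle (suc N) g = begin
    ∑[ Q < N ] ∑[ q < suc Q ] g q (Q ∸ q) + ∑[ q < suc N ] g q (N ∸ q)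
      ≡⟨ cong (_+ ∑[ q < suc N ] g q (N ∸ q)) (∑-triangle N g) ⟩
    ∑[ q < N ] ∑ (N ∸ q) (g q) + (∑[ q < N ] g q (N ∸ q) + g N (N ∸ N))
      ≡⟨ cong (λ d → ∑[ q < N ] ∑ (N ∸ q) (g q) + (∑[ q < N ] g q (N ∸ q) + g N d)) (ℕP.n∸n≡0 N) ⟩
    ∑[ q < N ] ∑ (N ∸ q) (g q) + (∑[ q < N ] g q (N ∸ q) + g N 0)
      ≡⟨ ℤP.+-assoc (∑[ q < N ] ∑ (N ∸ q) (g q)) (∑[ q < N ] g q (N ∸ q)) (g N 0) ⟨
    ∑[ q < N ] ∑ (N ∸ q) (g q) + ∑[ q < N ] g q (N ∸ q) + g N 0
      ≡⟨ cong (_+ g N 0) (∑-distrib-+ N (λ q → ∑ (N ∸ q) (g q)) (λ q → g q (N ∸ q))) ⟨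
    ∑[ q < N ] ∑ (suc (N ∸ q)) (g q) + g N 0
      ≡⟨ cong₂ _+_ (∑-cong N (λ q q<N → cong (λ l → ∑ l (g q)) (sym (ℕP.+-∸-assoc 1 (ℕP.<⇒≤ q<N)))))
                   (sym (ℤP.+-identityˡ (g N 0))) ⟩
    ∑[ q < N ] ∑ (suc N ∸ q) (g q) + ∑ 1 (g N)
      ≡⟨ cong (λ l → ∑[ q < N ] ∑ (suc N ∸ q) (g q) + ∑ l (g N)) (ℕP.m+n∸n≡m 1 N) ⟨
    ∑[ q < N ] ∑ (suc N ∸ q) (g q) + ∑ (suc N ∸ N) (g N)
      ∎
    where open ≡-Reasoning

  ∑-by-parts : ∀ n (g e : ℕ → ℤ) →
    ∑[ j < suc n ] (g j * (e j - e (suc j))) ≡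
    g 0 * e 0 + ∑[ j < n ] ((g (suc j) - g j) * e (suc j)) - g n * e (suc n)
  ∑-by-parts zero    g e = ring (g 0) (e 0) (e 1)
    where ring : ∀ g₀ e₀ e₁ → 0ℤ + g₀ * (e₀ - e₁) ≡ g₀ * e₀ + 0ℤ - g₀ * e₁
          ring = solve-∀
  ∑-by-parts (suc n) g e rewrite ∑-by-parts n g e =
    ring (g 0 * e 0) (∑[ j < n ] ((g (suc j) - g j) * e (suc j))) (g n) (g (suc n)) (e (suc n)) (e (suc (suc n)))
    where ring : ∀ h S gₙ gₙ₊₁ eₙ₊₁ eₙ₊₂ →
                 h + S - gₙ * eₙ₊₁ + gₙ₊₁ * (eₙ₊₁ - eₙ₊₂) ≡ h + (S + (gₙ₊₁ - gₙ) * eₙ₊₁) - gₙ₊₁ * eₙ₊₂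
          ring = solve-∀

  sum-applyUpTo : ∀ n (h : ℕ → ℕ) (f : ℕ → ℤ) → sumℤ (map f (applyUpTo h n)) ≡ ∑[ i < n ] f (h i)
  sum-applyUpTo zero    h f = refl
  sum-applyUpTo (suc n) h f = begin
    f (h 0) + sumℤ (map f (applyUpTo (h ∘ suc) n)) ≡⟨ cong (f (h 0) +_) (sum-applyUpTo n (h ∘ suc) f) ⟩
    f (h 0) + ∑[ i < n ] f (h (suc i))             ≡⟨ ∑-sucˡ n (f ∘ h) ⟨
    ∑[ i < suc n ] f (h i)                         ∎
    where open ≡-Reasoning

  sum-upTo : ∀ n (f : ℕ → ℤ) → sumℤ (map f (upTo n)) ≡ ∑ n f
  sum-upTo n = sum-applyUpTo n id

  𝟙[_≤_] : ℕ → ℕ → ℤ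
  𝟙[ u ≤ n ] with u ≤? n
  ... | yes _ = 1ℤ
  ... | no  _ = 0ℤ

  𝟙-≤ : ∀ {u n} → u ≤ n → 𝟙[ u ≤ n ] ≡ 1ℤ
  𝟙-≤ {u} {n} u≤n with u ≤? n
  ... | yes _   = refl
  ... | no  u≰n = contradiction u≤n u≰n

  𝟙-> : ∀ {u n} → n < u → 𝟙[ u ≤ n ] ≡ 0ℤ
  𝟙-> {u} {n} n<u with u ≤? n
  ... | yes u≤n = contradiction u≤n (ℕP.<⇒≱ n<u)
  ... | no  _   = refl

  -- f at n - u, but 0 (rather than f 0, as truncated subtraction would give) when u > n
  infix 30 _⟪_⊖_⟫
  _⟪_⊖_⟫ : (ℕ → ℤ) → ℕ → ℕ → ℤ
  f ⟪ n ⊖ u ⟫ = 𝟙[ u ≤ n ] * f (n ∸ u)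

  ⟪⊖⟫-≤ : ∀ (f : ℕ → ℤ) {u n} → u ≤ n → f ⟪ n ⊖ u ⟫ ≡ f (n ∸ u)
  ⟪⊖⟫-≤ f {u} {n} u≤n = trans (cong (_* f (n ∸ u)) (𝟙-≤ u≤n)) (ℤP.*-identityˡ (f (n ∸ u)))

  ⟪⊖⟫-> : ∀ (f : ℕ → ℤ) {u n} → n < u → f ⟪ n ⊖ u ⟫ ≡ 0ℤ
  ⟪⊖⟫-> f {u} {n} n<u = trans (cong (_* f (n ∸ u)) (𝟙-> n<u)) (ℤP.*-zeroˡ (f (n ∸ u)))

  ⟪⊖⟫-+ : ∀ (f : ℕ → ℤ) u v n → (λ m → f ⟪ m ⊖ v ⟫) ⟪ n ⊖ u ⟫ ≡ f ⟪ n ⊖ u ℕ.+ v ⟫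
  ⟪⊖⟫-+ f u v n with ℕP.≤-<-connex (u ℕ.+ v) n
  ... | inj₁ u+v≤n = begin
    (λ m → f ⟪ m ⊖ v ⟫) ⟪ n ⊖ u ⟫ ≡⟨ ⟪⊖⟫-≤ (λ m → f ⟪ m ⊖ v ⟫) (ℕP.m+n≤o⇒m≤o u u+v≤n) ⟩
    f ⟪ n ∸ u ⊖ v ⟫               ≡⟨ ⟪⊖⟫-≤ f (ℕP.m+n≤o⇒m≤o∸n v (subst (_≤ n) (ℕP.+-comm u v) u+v≤n)) ⟩
    f (n ∸ u ∸ v)                 ≡⟨ cong f (ℕP.∸-+-assoc n u v) ⟩
    f (n ∸ (u ℕ.+ v))             ≡⟨ ⟪⊖⟫-≤ f u+v≤n ⟨
    f ⟪ n ⊖ u ℕ.+ v ⟫             ∎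
    where open ≡-Reasoning
  ... | inj₂ n<u+v with ℕP.≤-<-connex u n
  ...   | inj₂ n<u = trans (⟪⊖⟫-> (λ m → f ⟪ m ⊖ v ⟫) n<u) (sym (⟪⊖⟫-> f n<u+v))
  ...   | inj₁ u≤n = begin
    (λ m → f ⟪ m ⊖ v ⟫) ⟪ n ⊖ u ⟫ ≡⟨ ⟪⊖⟫-≤ (λ m → f ⟪ m ⊖ v ⟫) u≤n ⟩
    f ⟪ n ∸ u ⊖ v ⟫               ≡⟨ ⟪⊖⟫-> f (ℕP.+-cancelˡ-< u (n ∸ u) v (subst (_< u ℕ.+ v) (sym (ℕP.m+[n∸m]≡n u≤n)) n<u+v)) ⟩
    0ℤ                            ≡⟨ ⟪⊖⟫-> f n<u+v ⟨
    f ⟪ n ⊖ u ℕ.+ v ⟫             ∎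
    where open ≡-Reasoning

  ∑-𝟙≤ : ∀ {n K} (h : ℕ → ℤ) → suc n ≤ K → ∑[ i < K ] (𝟙[ i ≤ n ] * h i) ≡ ∑ (suc n) h
  ∑-𝟙≤ {n} {K} h n<K = begin
    ∑[ i < K ] (𝟙[ i ≤ n ] * h i)     ≡⟨ ∑-truncate (λ i → 𝟙[ i ≤ n ] * h i) n<K
                                           (λ i n<i _ → trans (cong (_* h i) (𝟙-> n<i)) (ℤP.*-zeroˡ (h i))) ⟩
    ∑[ i < suc n ] (𝟙[ i ≤ n ] * h i) ≡⟨ ∑-cong (suc n) (λ i i≤n →
                                           trans (cong (_* h i) (𝟙-≤ (ℕP.≤-pred i≤n))) (ℤP.*-identityˡ (h i))) ⟩
    ∑ (suc n) h                       ∎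
    where open ≡-Reasoning

  ∑-triangle-support : ∀ n (g : ℕ → ℕ → ℤ) → (∀ q Q′ → n < q ℕ.+ Q′ → g q Q′ ≡ 0ℤ) →
    ∑[ Q < suc n ] ∑[ q < suc Q ] g q (Q ∸ q) ≡ ∑[ q < suc n ] ∑[ Q′ < suc n ] g q Q′
  ∑-triangle-support n g g≡0 = begin
    ∑[ Q < suc n ] ∑[ q < suc Q ] g q (Q ∸ q) ≡⟨ ∑-triangle (suc n) g ⟩
    ∑[ q < suc n ] ∑ (suc n ∸ q) (g q)        ≡⟨ ∑-cong (suc n) (λ q q≤n → sym (∑-truncate (g q) (ℕP.m∸n≤m (suc n) q)
                                                   (λ Q′ n+1-q≤Q′ _ → g≡0 q Q′ (beyond q Q′ (ℕP.<⇒≤ q≤n) n+1-q≤Q′)))) ⟩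
    ∑[ q < suc n ] ∑[ Q′ < suc n ] g q Q′     ∎
    where
    open ≡-Reasoning
    beyond : ∀ q Q′ → q ≤ suc n → suc n ∸ q ≤ Q′ → n < q ℕ.+ Q′
    beyond q Q′ q≤n+1 n+1-q≤Q′ = subst (_≤ q ℕ.+ Q′) (ℕP.m+[n∸m]≡n q≤n+1) (ℕP.+-monoʳ-≤ q n+1-q≤Q′)

module CompositionSums where
  open import Data.Integer using (_+_; _*_)
  open FiniteSums

  ∑ᶜ : (k n : ℕ) → (Vec ℕ k → ℤ) → ℤ
  ∑ᶜ k n F = sumℤ (map F (compositions k n))

  sumℤ-++ : ∀ xs ys → sumℤ (xs ++ ys) ≡ sumℤ xs + sumℤ ys
  sumℤ-++ []       ys = sym (ℤP.+-identityˡ (sumℤ ys))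
  sumℤ-++ (x ∷ xs) ys rewrite sumℤ-++ xs ys = sym (ℤP.+-assoc x (sumℤ xs) (sumℤ ys))

  sumℤ-concatMap : ∀ {A B : Set} (F : B → ℤ) (g : A → List B) xs →
                   sumℤ (map F (concatMap g xs)) ≡ sumℤ (map (λ x → sumℤ (map F (g x))) xs)
  sumℤ-concatMap F g []       = refl
  sumℤ-concatMap F g (x ∷ xs) = begin
    sumℤ (map F (g x ++ concatMap g xs))                     ≡⟨ cong sumℤ (map-++ F (g x) (concatMap g xs)) ⟩
    sumℤ (map F (g x) ++ map F (concatMap g xs))             ≡⟨ sumℤ-++ (map F (g x)) (map F (concatMap g xs)) ⟩
    sumℤ (map F (g x)) + sumℤ (map F (concatMap g xs))       ≡⟨ cong (sumℤ (map F (g x)) +_) (sumℤ-concatMap F g xs) ⟩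
    sumℤ (map F (g x)) + sumℤ (map (λ y → sumℤ (map F (g y))) xs) ∎
    where open ≡-Reasoning

  ∑ᶜ-suc : ∀ k n (F : Vec ℕ (suc k) → ℤ) → ∑ᶜ (suc k) n F ≡ ∑[ i < suc n ] ∑ᶜ k (n ∸ i) (F ∘ (i ∷_))
  ∑ᶜ-suc k n F = begin
    sumℤ (map F (concatMap (λ i → map (i ∷_) (compositions k (n ∸ i))) (upTo (suc n))))
      ≡⟨ sumℤ-concatMap F (λ i → map (i ∷_) (compositions k (n ∸ i))) (upTo (suc n)) ⟩
    sumℤ (map (λ i → sumℤ (map F (map (i ∷_) (compositions k (n ∸ i))))) (upTo (suc n)))
      ≡⟨ sum-upTo (suc n) _ ⟩
    ∑[ i < suc n ] sumℤ (map F (map (i ∷_) (compositions k (n ∸ i))))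
      ≡⟨ ∑-cong (suc n) (λ i _ → cong sumℤ (sym (map-∘ (compositions k (n ∸ i))))) ⟩
    ∑[ i < suc n ] ∑ᶜ k (n ∸ i) (F ∘ (i ∷_)) ∎
    where open ≡-Reasoning

  ∑ᶜ-cong : ∀ k n {F G : Vec ℕ k → ℤ} → (∀ ms → vsum ms ≡ n → F ms ≡ G ms) → ∑ᶜ k n F ≡ ∑ᶜ k n G
  ∑ᶜ-cong zero    zero    F≡G = cong (_+ 0ℤ) (F≡G [] refl)
  ∑ᶜ-cong zero    (suc n) F≡G = refl
  ∑ᶜ-cong (suc k) n {F} {G} F≡G = begin
    ∑ᶜ (suc k) n F                           ≡⟨ ∑ᶜ-suc k n F ⟩
    ∑[ i < suc n ] ∑ᶜ k (n ∸ i) (F ∘ (i ∷_)) ≡⟨ ∑-cong (suc n) (λ i i≤n → ∑ᶜ-cong k (n ∸ i) (λ ms tot≡ →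
                                                  F≡G (i ∷ ms) (trans (cong (i ℕ.+_) tot≡) (ℕP.m+[n∸m]≡n (ℕP.≤-pred i≤n))))) ⟩
    ∑[ i < suc n ] ∑ᶜ k (n ∸ i) (G ∘ (i ∷_)) ≡⟨ ∑ᶜ-suc k n G ⟨
    ∑ᶜ (suc k) n G                           ∎
    where open ≡-Reasoning

  *-distribˡ-sumℤ : ∀ {A : Set} c (F : A → ℤ) xs → c * sumℤ (map F xs) ≡ sumℤ (map (λ y → c * F y) xs)
  *-distribˡ-sumℤ c F []       = ℤP.*-zeroʳ c
  *-distribˡ-sumℤ c F (x ∷ xs) =
    trans (ℤP.*-distribˡ-+ c (F x) (sumℤ (map F xs))) (cong (c * F x +_) (*-distribˡ-sumℤ c F xs))

  *-distribˡ-∑ᶜ : ∀ k n c (F : Vec ℕ k → ℤ) → c * ∑ᶜ k n F ≡ ∑ᶜ k n (λ ms → c * F ms)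
  *-distribˡ-∑ᶜ k n c F = *-distribˡ-sumℤ c F (compositions k n)

module CompositionCounts where
  open import Data.Integer using (_+_; _*_; -_; _-_)
  open FiniteSums
  open import Data.Nat.Combinatorics using (nCn≡1; nCk+nC[k+1]≡[n+1]C[k+1]; k>n⇒nCk≡0) renaming (_C_ to binom)

  weakCompositionCount : ℕ → ℕ → ℤ
  weakCompositionCount zero    m = 𝟙[ m ≤ 0 ]
  weakCompositionCount (suc k) m = ∑[ i < suc m ] weakCompositionCount k i

  weakCompositionCount-binom : ∀ k m → weakCompositionCount (suc k) m ≡ ℤ.+ binom (m ℕ.+ k) k
  weakCompositionCount-binom zero    zero    = refl
  weakCompositionCount-binom zero    (suc m) = cong (_+ 0ℤ) (weakCompositionCount-binom zero m)
  weakCompositionCount-binom (suc k) zero    = begin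
    0ℤ + weakCompositionCount (suc k) 0 ≡⟨ ℤP.+-identityˡ _ ⟩
    weakCompositionCount (suc k) 0      ≡⟨ weakCompositionCount-binom k 0 ⟩
    ℤ.+ binom k k                       ≡⟨ cong ℤ.+_ (trans (nCn≡1 k) (sym (nCn≡1 (suc k)))) ⟩
    ℤ.+ binom (suc k) (suc k)           ∎
    where open ≡-Reasoning
  weakCompositionCount-binom (suc k) (suc m) = begin
    weakCompositionCount (suc (suc k)) m + weakCompositionCount (suc k) (suc m)
      ≡⟨ cong₂ _+_ (weakCompositionCount-binom (suc k) m) (weakCompositionCount-binom k (suc m)) ⟩
    ℤ.+ binom (m ℕ.+ suc k) (suc k) + ℤ.+ binom (suc m ℕ.+ k) k
      ≡⟨ cong (λ n → ℤ.+ binom (m ℕ.+ suc k) (suc k) + ℤ.+ binom n k) (ℕP.+-suc m k) ⟨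
    ℤ.+ (binom (m ℕ.+ suc k) (suc k) ℕ.+ binom (m ℕ.+ suc k) k)
      ≡⟨ cong ℤ.+_ (trans (ℕP.+-comm (binom (m ℕ.+ suc k) (suc k)) (binom (m ℕ.+ suc k) k))
                          (nCk+nC[k+1]≡[n+1]C[k+1] (m ℕ.+ suc k) k)) ⟩
    ℤ.+ binom (suc m ℕ.+ suc k) (suc k) ∎
    where open ≡-Reasoning

  alternatingBinom : ℕ → ℕ → ℤ
  alternatingBinom k j = (- 1ℤ) ℤ.^ j * ℤ.+ binom k j

  alternatingBinom-pascal : ∀ k j →
    alternatingBinom (suc k) (suc j) ≡ alternatingBinom k (suc j) - alternatingBinom k j
  alternatingBinom-pascal k j = begin
    (- 1ℤ) ℤ.^ suc j * ℤ.+ binom (suc k) (suc j)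
      ≡⟨ cong (λ b → (- 1ℤ) ℤ.^ suc j * ℤ.+ b) (nCk+nC[k+1]≡[n+1]C[k+1] k j) ⟨
    (- 1ℤ) * (- 1ℤ) ℤ.^ j * (ℤ.+ binom k j + ℤ.+ binom k (suc j))
      ≡⟨ ring ((- 1ℤ) ℤ.^ j) (ℤ.+ binom k j) (ℤ.+ binom k (suc j)) ⟩
    (- 1ℤ) ℤ.^ suc j * ℤ.+ binom k (suc j) - (- 1ℤ) ℤ.^ j * ℤ.+ binom k j ∎
    where
    open ≡-Reasoning
    ring : ∀ σ x y → (- 1ℤ) * σ * (x + y) ≡ (- 1ℤ) * σ * y - σ * x
    ring = solve-∀

  alternatingBinom-diagonal : ∀ k → alternatingBinom (suc k) (suc k) ≡ - alternatingBinom k k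
  alternatingBinom-diagonal k = begin
    alternatingBinom (suc k) (suc k)                           ≡⟨ alternatingBinom-pascal k k ⟩
    (- 1ℤ) ℤ.^ suc k * ℤ.+ binom k (suc k) - alternatingBinom k k
      ≡⟨ cong (λ b → (- 1ℤ) ℤ.^ suc k * ℤ.+ b - alternatingBinom k k) (k>n⇒nCk≡0 (ℕP.n<1+n k)) ⟩
    (- 1ℤ) ℤ.^ suc k * 0ℤ - alternatingBinom k k               ≡⟨ ring ((- 1ℤ) ℤ.^ suc k) (alternatingBinom k k) ⟩
    - alternatingBinom k k                                     ∎
    where
    open ≡-Reasoning
    ring : ∀ σ x → σ * 0ℤ - x ≡ - x
    ring = solve-∀

  -- Coefficientwise, (1 - X) ^ (k + 1) = (1 - X) * (1 - X) ^ k.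
  ∑-alternatingBinom-by-parts : ∀ k (e : ℕ → ℤ) →
    ∑[ j < suc k ] (alternatingBinom k j * (e j - e (suc j))) ≡
    ∑[ j < suc (suc k) ] (alternatingBinom (suc k) j * e j)
  ∑-alternatingBinom-by-parts k e = begin
    ∑[ j < suc k ] (c k j * (e j - e (suc j)))
      ≡⟨ ∑-by-parts k (c k) e ⟩
    c k 0 * e 0 + ∑[ j < k ] ((c k (suc j) - c k j) * e (suc j)) - c k k * e (suc k)
      ≡⟨ cong₂ (λ x y → c k 0 * e 0 + x - y * e (suc k))
           (∑-cong k (λ j _ → cong (_* e (suc j)) (sym (alternatingBinom-pascal k j))))
           (trans (sym (ℤP.neg-involutive (c k k))) (cong -_ (sym (alternatingBinom-diagonal k)))) ⟩
    c k 0 * e 0 + ∑[ j < k ] (c (suc k) (suc j) * e (suc j)) - (- c (suc k) (suc k)) * e (suc k)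
      ≡⟨ ring (c k 0 * e 0) (∑[ j < k ] (c (suc k) (suc j) * e (suc j))) (c (suc k) (suc k)) (e (suc k)) ⟩
    c k 0 * e 0 + ∑[ j < k ] (c (suc k) (suc j) * e (suc j)) + c (suc k) (suc k) * e (suc k)
      ≡⟨ cong (_+ c (suc k) (suc k) * e (suc k)) (∑-sucˡ k (λ j → c (suc k) j * e j)) ⟨
    ∑[ j < suc (suc k) ] (c (suc k) j * e j) ∎
    where
    open ≡-Reasoning
    c = alternatingBinom
    ring : ∀ h S x y → h + S - (- x) * y ≡ h + S + x * y
    ring = solve-∀

module BoundedCompositionCounts (a : ℕ) where
  open import Data.Integer using (_+_; _*_; -_; _-_)
  open FiniteSums
  open CompositionCounts
  open import Data.Nat.Combinatorics using (k>n⇒nCk≡0) renaming (_C_ to binom)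

  windowSum : (ℕ → ℤ) → ℕ → ℤ
  windowSum f m = ∑[ t < a ] f ⟪ m ⊖ t ⟫

  -- compositions of m into k parts, each less than a
  boundedCompositionCount : ℕ → ℕ → ℤ
  boundedCompositionCount zero    m = 𝟙[ m ≤ 0 ]
  boundedCompositionCount (suc k) m = windowSum (boundedCompositionCount k) m

  windowSum-cong : ∀ {f g : ℕ → ℤ} → (∀ m → f m ≡ g m) → ∀ m → windowSum f m ≡ windowSum g m
  windowSum-cong f≡g m = ∑-cong a (λ t _ → cong (𝟙[ t ≤ m ] *_) (f≡g (m ∸ t)))

  windowSum-linear : ∀ J (c : ℕ → ℤ) (g : ℕ → ℕ → ℤ) m →
    windowSum (λ m′ → ∑[ j < J ] (c j * g j m′)) m ≡ ∑[ j < J ] (c j * windowSum (g j) m)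
  windowSum-linear J c g m = begin
    ∑[ t < a ] (𝟙[ t ≤ m ] * ∑[ j < J ] (c j * g j (m ∸ t)))
      ≡⟨ ∑-cong a (λ t _ → *-distribˡ-∑ J 𝟙[ t ≤ m ] (λ j → c j * g j (m ∸ t))) ⟩
    ∑[ t < a ] ∑[ j < J ] (𝟙[ t ≤ m ] * (c j * g j (m ∸ t)))
      ≡⟨ ∑-comm a J (λ t j → 𝟙[ t ≤ m ] * (c j * g j (m ∸ t))) ⟩
    ∑[ j < J ] ∑[ t < a ] (𝟙[ t ≤ m ] * (c j * g j (m ∸ t)))
      ≡⟨ ∑-cong J (λ j _ → ∑-cong a (λ t _ → swap 𝟙[ t ≤ m ] (c j) (g j (m ∸ t)))) ⟩
    ∑[ j < J ] ∑[ t < a ] (c j * g j ⟪ m ⊖ t ⟫)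
      ≡⟨ ∑-cong J (λ j _ → *-distribˡ-∑ a (c j) (λ t → g j ⟪ m ⊖ t ⟫)) ⟨
    ∑[ j < J ] (c j * windowSum (g j) m) ∎
    where
    open ≡-Reasoning
    swap : ∀ x y z → x * (y * z) ≡ y * (x * z)
    swap = solve-∀

  windowSum-⟪⊖⟫ : ∀ (f : ℕ → ℤ) u m → windowSum (λ m′ → f ⟪ m′ ⊖ u ⟫) m ≡ windowSum f ⟪ m ⊖ u ⟫
  windowSum-⟪⊖⟫ f u m = begin
    ∑[ t < a ] (λ m′ → f ⟪ m′ ⊖ u ⟫) ⟪ m ⊖ t ⟫ ≡⟨ ∑-cong a (λ t _ → ⟪⊖⟫-+ f t u m) ⟩
    ∑[ t < a ] f ⟪ m ⊖ t ℕ.+ u ⟫              ≡⟨ ∑-cong a (λ t _ → cong (λ v → f ⟪ m ⊖ v ⟫) (ℕP.+-comm t u)) ⟩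
    ∑[ t < a ] f ⟪ m ⊖ u ℕ.+ t ⟫              ≡⟨ ∑-cong a (λ t _ → ⟪⊖⟫-+ f u t m) ⟨
    ∑[ t < a ] (𝟙[ u ≤ m ] * f ⟪ m ∸ u ⊖ t ⟫) ≡⟨ *-distribˡ-∑ a 𝟙[ u ≤ m ] (λ t → f ⟪ m ∸ u ⊖ t ⟫) ⟨
    windowSum f ⟪ m ⊖ u ⟫                     ∎
    where open ≡-Reasoning

  windowSum-weakCompositionCount : ∀ k M →
    windowSum (weakCompositionCount k) M ≡
    weakCompositionCount (suc k) M - weakCompositionCount (suc k) ⟪ M ⊖ a ⟫
  windowSum-weakCompositionCount k M with ℕP.≤-<-connex a M
  ... | inj₁ a≤M = begin
    ∑[ t < a ] B k ⟪ M ⊖ t ⟫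
      ≡⟨ ∑-cong a (λ t t<a → ⟪⊖⟫-≤ (B k) (ℕP.≤-trans (ℕP.<⇒≤ t<a) a≤M)) ⟩
    ∑[ t < a ] B k (M ∸ t)
      ≡⟨ cancel (∑[ t < a ] B k (M ∸ t)) (∑[ t < suc M ∸ a ] B k (M ∸ (a ℕ.+ t))) ⟨
    ∑[ t < a ] B k (M ∸ t) + ∑[ t < suc M ∸ a ] B k (M ∸ (a ℕ.+ t)) - ∑[ t < suc M ∸ a ] B k (M ∸ (a ℕ.+ t))
      ≡⟨ cong₂ _-_ (∑-+ a (suc M ∸ a) (λ t → B k (M ∸ t))) tail ⟨
    ∑[ t < a ℕ.+ (suc M ∸ a) ] B k (M ∸ t) - B (suc k) (M ∸ a)
      ≡⟨ cong₂ _-_ (trans (cong (λ n → ∑[ t < n ] B k (M ∸ t)) (ℕP.m+[n∸m]≡n (ℕP.m≤n⇒m≤1+n a≤M)))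
                          (sym (∑-reverse (suc M) (B k))))
                   (sym (⟪⊖⟫-≤ (B (suc k)) a≤M)) ⟩
    B (suc k) M - B (suc k) ⟪ M ⊖ a ⟫ ∎
    where
    open ≡-Reasoning
    B = weakCompositionCount
    cancel : ∀ x y → x + y - y ≡ x
    cancel = solve-∀
    tail : B (suc k) (M ∸ a) ≡ ∑[ t < suc M ∸ a ] B k (M ∸ (a ℕ.+ t))
    tail = begin
      B (suc k) (M ∸ a)                       ≡⟨ ∑-reverse (suc (M ∸ a)) (B k) ⟩
      ∑[ t < suc (M ∸ a) ] B k (M ∸ a ∸ t)    ≡⟨ ∑-cong (suc (M ∸ a)) (λ t _ → cong (B k) (ℕP.∸-+-assoc M a t)) ⟩
      ∑[ t < suc (M ∸ a) ] B k (M ∸ (a ℕ.+ t)) ≡⟨ cong (λ n → ∑[ t < n ] B k (M ∸ (a ℕ.+ t))) (ℕP.+-∸-assoc 1 a≤M) ⟨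
      ∑[ t < suc M ∸ a ] B k (M ∸ (a ℕ.+ t))  ∎
  ... | inj₂ M<a = begin
    ∑[ t < a ] B k ⟪ M ⊖ t ⟫            ≡⟨ ∑-𝟙≤ (λ t → B k (M ∸ t)) M<a ⟩
    ∑[ t < suc M ] B k (M ∸ t)          ≡⟨ ∑-reverse (suc M) (B k) ⟨
    B (suc k) M                         ≡⟨ ℤP.+-identityʳ (B (suc k) M) ⟨
    B (suc k) M - 0ℤ                    ≡⟨ cong (λ y → B (suc k) M - y) (⟪⊖⟫-> (B (suc k)) M<a) ⟨
    B (suc k) M - B (suc k) ⟪ M ⊖ a ⟫   ∎
    where
    open ≡-Reasoning
    B = weakCompositionCount

  boundedCompositionCount-inclusion-exclusion : ∀ k m →
    boundedCompositionCount k m ≡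
    ∑[ j < suc k ] (alternatingBinom k j * weakCompositionCount k ⟪ m ⊖ j ℕ.* a ⟫)
  boundedCompositionCount-inclusion-exclusion zero    m = ring 𝟙[ m ≤ 0 ]
    where ring : ∀ x → x ≡ 0ℤ + 1ℤ * (1ℤ * x)
          ring = solve-∀
  boundedCompositionCount-inclusion-exclusion (suc k) m = begin
    windowSum (boundedCompositionCount k) m
      ≡⟨ windowSum-cong (boundedCompositionCount-inclusion-exclusion k) m ⟩
    windowSum (λ m′ → ∑[ j < suc k ] (c k j * B k ⟪ m′ ⊖ j ℕ.* a ⟫)) m
      ≡⟨ windowSum-linear (suc k) (c k) (λ j m′ → B k ⟪ m′ ⊖ j ℕ.* a ⟫) m ⟩
    ∑[ j < suc k ] (c k j * windowSum (λ m′ → B k ⟪ m′ ⊖ j ℕ.* a ⟫) m)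
      ≡⟨ ∑-cong (suc k) (λ j _ → cong (c k j *_) (window j)) ⟩
    ∑[ j < suc k ] (c k j * (B (suc k) ⟪ m ⊖ j ℕ.* a ⟫ - B (suc k) ⟪ m ⊖ suc j ℕ.* a ⟫))
      ≡⟨ ∑-alternatingBinom-by-parts k (λ j → B (suc k) ⟪ m ⊖ j ℕ.* a ⟫) ⟩
    ∑[ j < suc (suc k) ] (c (suc k) j * B (suc k) ⟪ m ⊖ j ℕ.* a ⟫) ∎
    where
    open ≡-Reasoning
    B = weakCompositionCount
    c = alternatingBinom
    window : ∀ j → windowSum (λ m′ → B k ⟪ m′ ⊖ j ℕ.* a ⟫) m ≡ B (suc k) ⟪ m ⊖ j ℕ.* a ⟫ - B (suc k) ⟪ m ⊖ suc j ℕ.* a ⟫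
    window j = begin
      windowSum (λ m′ → B k ⟪ m′ ⊖ j ℕ.* a ⟫) m
        ≡⟨ windowSum-⟪⊖⟫ (B k) (j ℕ.* a) m ⟩
      𝟙[ j ℕ.* a ≤ m ] * windowSum (B k) (m ∸ j ℕ.* a)
        ≡⟨ cong (𝟙[ j ℕ.* a ≤ m ] *_) (windowSum-weakCompositionCount k (m ∸ j ℕ.* a)) ⟩
      𝟙[ j ℕ.* a ≤ m ] * (B (suc k) (m ∸ j ℕ.* a) - B (suc k) ⟪ m ∸ j ℕ.* a ⊖ a ⟫)
        ≡⟨ distrib 𝟙[ j ℕ.* a ≤ m ] (B (suc k) (m ∸ j ℕ.* a)) (B (suc k) ⟪ m ∸ j ℕ.* a ⊖ a ⟫) ⟩
      B (suc k) ⟪ m ⊖ j ℕ.* a ⟫ - (λ m′ → B (suc k) ⟪ m′ ⊖ a ⟫) ⟪ m ⊖ j ℕ.* a ⟫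
        ≡⟨ cong (B (suc k) ⟪ m ⊖ j ℕ.* a ⟫ -_) (trans (⟪⊖⟫-+ (B (suc k)) (j ℕ.* a) a m)
             (cong (λ v → B (suc k) ⟪ m ⊖ v ⟫) (ℕP.+-comm (j ℕ.* a) a))) ⟩
      B (suc k) ⟪ m ⊖ j ℕ.* a ⟫ - B (suc k) ⟪ m ⊖ suc j ℕ.* a ⟫ ∎
      where distrib : ∀ x y z → x * (y - z) ≡ x * y - x * z
            distrib = solve-∀

  boundedCompositionCount-vanish : ∀ k m → k ℕ.* (a ∸ 1) < m → boundedCompositionCount k m ≡ 0ℤ
  boundedCompositionCount-vanish zero    m 0<m = 𝟙-> 0<m
  boundedCompositionCount-vanish (suc k) m k+1*[a-1]<m = ∑-zero a λ t t<a →
    trans (cong (𝟙[ t ≤ m ] *_) (boundedCompositionCount-vanish k (m ∸ t) (bound t (ℕP.<⇒≤pred t<a))))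
          (ℤP.*-zeroʳ 𝟙[ t ≤ m ])
    where
    bound : ∀ t → t ≤ a ∸ 1 → k ℕ.* (a ∸ 1) < m ∸ t
    bound t t≤a-1 = ℕP.m+n≤o⇒m≤o∸n (suc (k ℕ.* (a ∸ 1))) (ℕP.≤-trans
      (ℕP.+-monoʳ-≤ (suc (k ℕ.* (a ∸ 1))) t≤a-1)
      (subst (_≤ m) (cong suc (ℕP.+-comm (a ∸ 1) (k ℕ.* (a ∸ 1)))) k+1*[a-1]<m))

  boundedCompositionCount-formula : ∀ k r l → r < a →
    boundedCompositionCount (suc k) (r ℕ.+ a ℕ.* l) ≡
    ∑[ j < suc l ] (alternatingBinom (suc k) j * ℤ.+ binom (r ℕ.+ (l ∸ j) ℕ.* a ℕ.+ k) k)
  boundedCompositionCount-formula k r l r<a =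
    trans (boundedCompositionCount-inclusion-exclusion (suc k) m)
          (∑-cong-support (suc (suc k)) (suc l) (λ j l<j _ → vanishes-above-l j l<j)
                                                (λ j k+1<j _ → vanishes-above-k j k+1<j) agree)
    where
    m = r ℕ.+ a ℕ.* l
    B = weakCompositionCount
    vanishes-above-l : ∀ j → suc l ≤ j → alternatingBinom (suc k) j * B (suc k) ⟪ m ⊖ j ℕ.* a ⟫ ≡ 0ℤ
    vanishes-above-l j l<j = trans (cong (alternatingBinom (suc k) j *_) (⟪⊖⟫-> (B (suc k)) m<ja))
                                   (ℤP.*-zeroʳ (alternatingBinom (suc k) j))
      where m<ja : m < j ℕ.* a
            m<ja = ℕP.<-≤-trans (ℕP.+-monoˡ-< (a ℕ.* l) r<a)
                     (subst (_≤ j ℕ.* a) (cong (a ℕ.+_) (ℕP.*-comm l a)) (ℕP.*-monoˡ-≤ a l<j))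
    vanishes-above-k : ∀ j → suc (suc k) ≤ j → alternatingBinom (suc k) j * ℤ.+ binom (r ℕ.+ (l ∸ j) ℕ.* a ℕ.+ k) k ≡ 0ℤ
    vanishes-above-k j k+1<j = trans (cong (λ b → (- 1ℤ) ℤ.^ j * ℤ.+ b * w) (k>n⇒nCk≡0 k+1<j)) (annihilate ((- 1ℤ) ℤ.^ j) w)
      where
      w = ℤ.+ binom (r ℕ.+ (l ∸ j) ℕ.* a ℕ.+ k) k
      annihilate : ∀ σ x → σ * 0ℤ * x ≡ 0ℤ
      annihilate = solve-∀
    agree : ∀ j → j < suc (suc k) → j < suc l →
            alternatingBinom (suc k) j * B (suc k) ⟪ m ⊖ j ℕ.* a ⟫ ≡
            alternatingBinom (suc k) j * ℤ.+ binom (r ℕ.+ (l ∸ j) ℕ.* a ℕ.+ k) k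
    agree j _ j≤l = cong (alternatingBinom (suc k) j *_) (begin
      B (suc k) ⟪ m ⊖ j ℕ.* a ⟫       ≡⟨ ⟪⊖⟫-≤ (B (suc k)) ja≤m ⟩
      B (suc k) (m ∸ j ℕ.* a)         ≡⟨ cong (B (suc k)) remainder ⟩
      B (suc k) (r ℕ.+ (l ∸ j) ℕ.* a) ≡⟨ weakCompositionCount-binom k (r ℕ.+ (l ∸ j) ℕ.* a) ⟩
      ℤ.+ binom (r ℕ.+ (l ∸ j) ℕ.* a ℕ.+ k) k ∎)
      where
      open ≡-Reasoning
      ja≤la : j ℕ.* a ≤ l ℕ.* a
      ja≤la = ℕP.*-monoˡ-≤ a (ℕP.≤-pred j≤l)
      ja≤m : j ℕ.* a ≤ m
      ja≤m = ℕP.≤-trans ja≤la (ℕP.≤-trans (ℕP.≤-reflexive (ℕP.*-comm l a)) (ℕP.m≤n+m (a ℕ.* l) r))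
      remainder : m ∸ j ℕ.* a ≡ r ℕ.+ (l ∸ j) ℕ.* a
      remainder = begin
        r ℕ.+ a ℕ.* l ∸ j ℕ.* a   ≡⟨ cong (λ x → r ℕ.+ x ∸ j ℕ.* a) (ℕP.*-comm a l) ⟩
        r ℕ.+ l ℕ.* a ∸ j ℕ.* a   ≡⟨ ℕP.+-∸-assoc r ja≤la ⟩
        r ℕ.+ (l ℕ.* a ∸ j ℕ.* a) ≡⟨ cong (r ℕ.+_) (ℕP.*-distribʳ-∸ a l j) ⟨
        r ℕ.+ (l ∸ j) ℕ.* a       ∎

module QuotientDecomposition (a : ℕ) .{{_ : ℕ.NonZero a}} where
  open import Data.Integer using (_+_; _*_)
  open FiniteSums
  open CompositionSums
  open BoundedCompositionCounts a
  open import Data.Nat.DivMod using (_/_; +-distrib-/-∣ˡ; m*n/n≡m; m<n⇒m/n≡0)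
  open import Data.Nat.Divisibility using (divides)
  import Data.Vec as Vec

  quotients : ∀ {k} → Vec ℕ k → Vec ℕ k
  quotients = Vec.map (_/ a)

  [a*q+t]/a≡q : ∀ q {t} → t < a → (a ℕ.* q ℕ.+ t) / a ≡ q
  [a*q+t]/a≡q q {t} t<a = begin
    (a ℕ.* q ℕ.+ t) / a   ≡⟨ +-distrib-/-∣ˡ t (divides q (ℕP.*-comm a q)) ⟩
    a ℕ.* q / a ℕ.+ t / a ≡⟨ cong₂ ℕ._+_ (trans (cong (_/ a) (ℕP.*-comm a q)) (m*n/n≡m q a)) (m<n⇒m/n≡0 t<a) ⟩
    q ℕ.+ 0               ≡⟨ ℕP.+-identityʳ q ⟩
    q                     ∎
    where open ≡-Reasoning

  ∑-divMod : ∀ n (h : ℕ → ℤ) →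
    ∑[ i < suc n ] h i ≡ ∑[ q < suc n ] ∑[ t < a ] (𝟙[ a ℕ.* q ℕ.+ t ≤ n ] * h (a ℕ.* q ℕ.+ t))
  ∑-divMod n h = trans (sym (∑-𝟙≤ h (ℕP.m≤n*m (suc n) a))) (∑-blocks a (suc n) (λ i → 𝟙[ i ≤ n ] * h i))

  -- the number of m with tot m = n whose vector of quotients by a is a given vector of total Q
  multiplicity : ℕ → ℕ → ℕ → ℤ
  multiplicity k n Q = boundedCompositionCount k ⟪ n ⊖ a ℕ.* Q ⟫

  multiplicity-vanish : ∀ k {n Q} → n < Q → multiplicity k n Q ≡ 0ℤ
  multiplicity-vanish k n<Q = ⟪⊖⟫-> (boundedCompositionCount k) (ℕP.<-≤-trans n<Q (ℕP.m≤n*m _ a))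

  multiplicity-zero : ∀ k n → multiplicity k n 0 ≡ boundedCompositionCount k n
  multiplicity-zero k n rewrite ℕP.*-zeroʳ a = ⟪⊖⟫-≤ (boundedCompositionCount k) z≤n

  multiplicity-suc : ∀ k n q Q′ →
    ∑[ t < a ] (λ m → multiplicity k m Q′) ⟪ n ⊖ a ℕ.* q ℕ.+ t ⟫ ≡ multiplicity (suc k) n (q ℕ.+ Q′)
  multiplicity-suc k n q Q′ = begin
    ∑[ t < a ] (λ m → N k ⟪ m ⊖ a ℕ.* Q′ ⟫) ⟪ n ⊖ a ℕ.* q ℕ.+ t ⟫
      ≡⟨ ∑-cong a (λ t _ → trans (⟪⊖⟫-+ (N k) (a ℕ.* q ℕ.+ t) (a ℕ.* Q′) n)
                                 (cong (λ v → N k ⟪ n ⊖ v ⟫) (regroup a q t Q′))) ⟩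
    ∑[ t < a ] N k ⟪ n ⊖ a ℕ.* (q ℕ.+ Q′) ℕ.+ t ⟫
      ≡⟨ ∑-cong a (λ t _ → ⟪⊖⟫-+ (N k) (a ℕ.* (q ℕ.+ Q′)) t n) ⟨
    ∑[ t < a ] (𝟙[ a ℕ.* (q ℕ.+ Q′) ≤ n ] * N k ⟪ n ∸ a ℕ.* (q ℕ.+ Q′) ⊖ t ⟫)
      ≡⟨ *-distribˡ-∑ a 𝟙[ a ℕ.* (q ℕ.+ Q′) ≤ n ] (λ t → N k ⟪ n ∸ a ℕ.* (q ℕ.+ Q′) ⊖ t ⟫) ⟨
    N (suc k) ⟪ n ⊖ a ℕ.* (q ℕ.+ Q′) ⟫ ∎
    where
    open ≡-Reasoning
    N = boundedCompositionCount
    regroup : ∀ a q t Q′ → a ℕ.* q ℕ.+ t ℕ.+ a ℕ.* Q′ ≡ a ℕ.* (q ℕ.+ Q′) ℕ.+ t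
    regroup = ℕ-solve-∀

  ∑-group-by-first-quotient : ∀ k n (H : ℕ → ℕ → ℤ) →
    ∑[ i < suc n ] ∑[ Q′ < suc (n ∸ i) ] (multiplicity k (n ∸ i) Q′ * H (i / a) Q′) ≡
    ∑[ q < suc n ] ∑[ Q′ < suc n ] (multiplicity (suc k) n (q ℕ.+ Q′) * H q Q′)
  ∑-group-by-first-quotient k n H = begin
    ∑[ i < suc n ] ∑[ Q′ < suc (n ∸ i) ] (multiplicity k (n ∸ i) Q′ * H (i / a) Q′)
      ≡⟨ ∑-cong (suc n) (λ i _ → sym (∑-truncate _ (s≤s (ℕP.m∸n≤m n i)) (λ Q′ n-i<Q′ _ →
           trans (cong (_* H (i / a) Q′) (multiplicity-vanish k n-i<Q′)) (ℤP.*-zeroˡ (H (i / a) Q′))))) ⟩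
    ∑[ i < suc n ] contribution i
      ≡⟨ ∑-divMod n contribution ⟩
    ∑[ q < suc n ] ∑[ t < a ] (𝟙[ a ℕ.* q ℕ.+ t ≤ n ] * contribution (a ℕ.* q ℕ.+ t))
      ≡⟨ ∑-cong (suc n) (λ q _ → ∑-cong a (λ t t<a → distribute q t t<a)) ⟩
    ∑[ q < suc n ] ∑[ t < a ] ∑[ Q′ < suc n ] ((λ m → multiplicity k m Q′) ⟪ n ⊖ a ℕ.* q ℕ.+ t ⟫ * H q Q′)
      ≡⟨ ∑-cong (suc n) (λ q _ → ∑-comm a (suc n) _) ⟩
    ∑[ q < suc n ] ∑[ Q′ < suc n ] ∑[ t < a ] ((λ m → multiplicity k m Q′) ⟪ n ⊖ a ℕ.* q ℕ.+ t ⟫ * H q Q′)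
      ≡⟨ ∑-cong (suc n) (λ q _ → ∑-cong (suc n) (λ Q′ _ →
           trans (sym (*-distribʳ-∑ a (H q Q′) _)) (cong (_* H q Q′) (multiplicity-suc k n q Q′)))) ⟩
    ∑[ q < suc n ] ∑[ Q′ < suc n ] (multiplicity (suc k) n (q ℕ.+ Q′) * H q Q′) ∎
    where
    open ≡-Reasoning
    contribution : ℕ → ℤ
    contribution i = ∑[ Q′ < suc n ] (multiplicity k (n ∸ i) Q′ * H (i / a) Q′)
    distribute : ∀ q t → t < a →
      𝟙[ a ℕ.* q ℕ.+ t ≤ n ] * contribution (a ℕ.* q ℕ.+ t) ≡
      ∑[ Q′ < suc n ] ((λ m → multiplicity k m Q′) ⟪ n ⊖ a ℕ.* q ℕ.+ t ⟫ * H q Q′)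
    distribute q t t<a = trans (*-distribˡ-∑ (suc n) 𝟙[ a ℕ.* q ℕ.+ t ≤ n ] _) (∑-cong (suc n) (λ Q′ _ →
      trans (sym (ℤP.*-assoc 𝟙[ a ℕ.* q ℕ.+ t ≤ n ] _ _))
            (cong (λ q′ → (λ m → multiplicity k m Q′) ⟪ n ⊖ a ℕ.* q ℕ.+ t ⟫ * H q′ Q′) ([a*q+t]/a≡q q t<a))))

  ∑-multiplicity-∑ᶜ-suc : ∀ k n (Ψ : Vec ℕ (suc k) → ℤ) →
    ∑[ Q < suc n ] (multiplicity (suc k) n Q * ∑ᶜ (suc k) Q Ψ) ≡
    ∑[ q < suc n ] ∑[ Q′ < suc n ] (multiplicity (suc k) n (q ℕ.+ Q′) * ∑ᶜ k Q′ (Ψ ∘ (q ∷_)))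
  ∑-multiplicity-∑ᶜ-suc k n Ψ = begin
    ∑[ Q < suc n ] (multiplicity (suc k) n Q * ∑ᶜ (suc k) Q Ψ)
      ≡⟨ ∑-cong (suc n) (λ Q _ → trans (cong (multiplicity (suc k) n Q *_) (∑ᶜ-suc k Q Ψ))
                                       (*-distribˡ-∑ (suc Q) (multiplicity (suc k) n Q) _)) ⟩
    ∑[ Q < suc n ] ∑[ q < suc Q ] (multiplicity (suc k) n Q * H q (Q ∸ q))
      ≡⟨ ∑-cong (suc n) (λ Q _ → ∑-cong (suc Q) (λ q q≤Q →
           cong (λ Q″ → multiplicity (suc k) n Q″ * H q (Q ∸ q)) (sym (ℕP.m+[n∸m]≡n (ℕP.≤-pred q≤Q))))) ⟩
    ∑[ Q < suc n ] ∑[ q < suc Q ] g q (Q ∸ q)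
      ≡⟨ ∑-triangle-support n g (λ q Q′ n<q+Q′ →
           trans (cong (_* H q Q′) (multiplicity-vanish (suc k) n<q+Q′)) (ℤP.*-zeroˡ (H q Q′))) ⟩
    ∑[ q < suc n ] ∑[ Q′ < suc n ] g q Q′ ∎
    where
    open ≡-Reasoning
    H : ℕ → ℕ → ℤ
    H q Q′ = ∑ᶜ k Q′ (Ψ ∘ (q ∷_))
    g : ℕ → ℕ → ℤ
    g q Q′ = multiplicity (suc k) n (q ℕ.+ Q′) * H q Q′

  ∑ᶜ-quotients : ∀ k n (Ψ : Vec ℕ k → ℤ) →
    ∑ᶜ k n (Ψ ∘ quotients) ≡ ∑[ Q < suc n ] (multiplicity k n Q * ∑ᶜ k Q Ψ)
  ∑ᶜ-quotients zero zero Ψ = begin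
    Ψ [] + 0ℤ                                ≡⟨ ring (Ψ []) ⟩
    0ℤ + 1ℤ * (Ψ [] + 0ℤ)                    ≡⟨ cong (λ w → 0ℤ + w * (Ψ [] + 0ℤ)) (multiplicity-zero zero 0) ⟨
    0ℤ + multiplicity zero 0 0 * (Ψ [] + 0ℤ) ∎
    where
    open ≡-Reasoning
    ring : ∀ x → x + 0ℤ ≡ 0ℤ + 1ℤ * (x + 0ℤ)
    ring = solve-∀
  ∑ᶜ-quotients zero (suc n) Ψ = sym (∑-zero (suc (suc n)) λ where
    zero    _ → trans (cong (_* ∑ᶜ zero 0 Ψ) (multiplicity-zero zero (suc n))) (ℤP.*-zeroˡ (∑ᶜ zero 0 Ψ))
    (suc Q) _ → ℤP.*-zeroʳ (multiplicity zero (suc n) (suc Q)))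
  ∑ᶜ-quotients (suc k) n Ψ = begin
    ∑ᶜ (suc k) n (Ψ ∘ quotients)
      ≡⟨ ∑ᶜ-suc k n (Ψ ∘ quotients) ⟩
    ∑[ i < suc n ] ∑ᶜ k (n ∸ i) (Ψ ∘ quotients ∘ (i ∷_))
      ≡⟨ ∑-cong (suc n) (λ i _ → ∑ᶜ-quotients k (n ∸ i) (Ψ ∘ (i / a ∷_))) ⟩
    ∑[ i < suc n ] ∑[ Q′ < suc (n ∸ i) ] (multiplicity k (n ∸ i) Q′ * ∑ᶜ k Q′ (Ψ ∘ (i / a ∷_)))
      ≡⟨ ∑-group-by-first-quotient k n (λ q Q′ → ∑ᶜ k Q′ (Ψ ∘ (q ∷_))) ⟩
    ∑[ q < suc n ] ∑[ Q′ < suc n ] (multiplicity (suc k) n (q ℕ.+ Q′) * ∑ᶜ k Q′ (Ψ ∘ (q ∷_)))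
      ≡⟨ ∑-multiplicity-∑ᶜ-suc k n Ψ ⟨
    ∑[ Q < suc n ] (multiplicity (suc k) n Q * ∑ᶜ (suc k) Q Ψ) ∎
    where open ≡-Reasoning

module ValuationUnfolding where
  open import Data.Nat using (_≟_)
  open import Data.Nat.Divisibility using (_∣_; _∣?_)
  open import Data.Nat.DivMod using (_/_)

  νAux-∤ : ∀ {p n} f → 1 < p → ¬ p ∣ n → νAux (suc f) p n ≡ 0
  νAux-∤ {suc (suc q)} {n} f _ p∤n with n ≟ 0 | suc (suc q) ∣? n
  ... | _     | yes p∣n = contradiction p∣n p∤n
  ... | yes _ | no  _   = refl
  ... | no  _ | no  _   = refl
  νAux-∤ {suc zero} f (s≤s ()) _

  νAux-∣ : ∀ {p n} .{{_ : NonZero p}} f → 1 < p → n ≢ 0 → p ∣ n → νAux (suc f) p n ≡ suc (νAux f p (n / p))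
  νAux-∣ {suc (suc q)} {n} f _ n≢0 p∣n with n ≟ 0 | suc (suc q) ∣? n
  ... | yes n≡0 | _       = contradiction n≡0 n≢0
  ... | no  _   | yes _   = refl
  ... | no  _   | no  p∤n = contradiction p∣n p∤n
  νAux-∣ {suc zero} f (s≤s ()) _ _

module Valuation (p : ℕ) .{{_ : NonTrivial p}} where
  open ValuationUnfolding
  open import Data.Nat using (_+_; _*_; _^_)
  open import Data.Nat.Divisibility
  open import Data.Nat.DivMod using (_/_; m*n/n≡m)
  open import Data.Nat.Primality using (Prime; euclidsLemma)
  open import Data.Nat.Combinatorics using (k![n∸k]!∣n!)

  private
    instance
      p≢0 : NonZero p
      p≢0 = ℕ.nonTrivial⇒nonZero p

    1<p : 1 < p
    1<p = ℕ.nonTrivial⇒n>1 p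

  ^-monoʳ-∣ : ∀ m {e v} → e ≤ v → m ^ e ∣ m ^ v
  ^-monoʳ-∣ m {e} {v} e≤v = divides (m ^ (v ∸ e))
    (trans (cong (m ^_) (sym (ℕP.m∸n+n≡m e≤v))) (ℕP.^-distribˡ-+-* m (v ∸ e) e))

  ∤⇒≢0 : ∀ {w} → ¬ p ∣ w → w ≢ 0
  ∤⇒≢0 p∤w refl = p∤w (p ∣0)

  νAux-decomposition : ∀ f n → n ≤ f → n ≢ 0 → ∃[ w ] (¬ p ∣ w × n ≡ p ^ νAux f p n * w)
  νAux-decomposition zero    zero    _   n≢0 = contradiction refl n≢0
  νAux-decomposition (suc f) n       n≤f n≢0 with p ∣? n
  ... | no p∤n rewrite νAux-∤ f 1<p p∤n = n , p∤n , sym (ℕP.*-identityˡ n)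
  ... | yes p∣n@(divides q n≡q*p) =
    let q≢0 : q ≢ 0
        q≢0 = λ { refl → n≢0 n≡q*p }
        q≤f : q ≤ f
        q≤f = ℕP.≤-pred (ℕP.<-≤-trans (subst (q <_) (sym n≡q*p) (ℕP.m<m*n q p {{ℕ.≢-nonZero q≢0}} 1<p)) n≤f)
        (w , p∤w , q≡p^v*w) = νAux-decomposition f q q≤f q≢0
    in w , p∤w , (begin
      n                              ≡⟨ n≡q*p ⟩
      q * p                          ≡⟨ ℕP.*-comm q p ⟩
      p * q                          ≡⟨ cong (p *_) q≡p^v*w ⟩
      p * (p ^ νAux f p q * w)       ≡⟨ ℕP.*-assoc p (p ^ νAux f p q) w ⟨
      p ^ suc (νAux f p q) * w       ≡⟨ cong (λ v → p ^ suc (νAux f p v) * w) (trans (cong (_/ p) n≡q*p) (m*n/n≡m q p)) ⟨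
      p ^ suc (νAux f p (n / p)) * w ≡⟨ cong (λ v → p ^ v * w) (νAux-∣ f 1<p n≢0 p∣n) ⟨
      p ^ νAux (suc f) p n * w       ∎)
    where open ≡-Reasoning

  ν-decomposition : ∀ {n} → n ≢ 0 → ∃[ w ] (¬ p ∣ w × n ≡ p ^ ν p n * w)
  ν-decomposition {n} = νAux-decomposition n n ℕP.≤-refl

  p^e∣p^v*w⇒e≤v : ∀ {e v w} → ¬ p ∣ w → p ^ e ∣ p ^ v * w → e ≤ v
  p^e∣p^v*w⇒e≤v {e} {v} {w} p∤w p^e∣p^v*w with ℕP.≤-<-connex e v
  ... | inj₁ e≤v = e≤v
  ... | inj₂ v<e = contradiction (*-cancelˡ-∣ (p ^ v) {{ℕP.m^n≢0 p v}} p^v*p∣p^v*w) p∤w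
    where p^v*p∣p^v*w : p ^ v * p ∣ p ^ v * w
          p^v*p∣p^v*w = subst (_∣ p ^ v * w) (ℕP.*-comm p (p ^ v)) (∣-trans (^-monoʳ-∣ p v<e) p^e∣p^v*w)

  p^e∣n⇒e≤ν : ∀ {e n} → n ≢ 0 → p ^ e ∣ n → e ≤ ν p n
  p^e∣n⇒e≤ν n≢0 p^e∣n with ν-decomposition n≢0
  ... | w , p∤w , n≡p^ν*w = p^e∣p^v*w⇒e≤v p∤w (subst (_ ∣_) n≡p^ν*w p^e∣n)

  p^ν∣n : ∀ n → p ^ ν p n ∣ n
  p^ν∣n zero = _ ∣0
  p^ν∣n n@(suc _) with ν-decomposition {n} (λ ())
  ... | w , _ , n≡p^ν*w = divides w (trans n≡p^ν*w (ℕP.*-comm _ w))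

  ν-exact : ∀ {e n} → n ≢ 0 → p ^ e ∣ n → ¬ p ^ suc e ∣ n → ν p n ≡ e
  ν-exact {e} {n} n≢0 p^e∣n p^1+e∤n = ℕP.≤-antisym ν≤e (p^e∣n⇒e≤ν n≢0 p^e∣n)
    where ν≤e : ν p n ≤ e
          ν≤e = ℕP.≮⇒≥ (λ e<ν → p^1+e∤n (∣-trans (^-monoʳ-∣ p e<ν) (p^ν∣n n)))

  ν[p^e*w]≡e : ∀ e {w} → ¬ p ∣ w → ν p (p ^ e * w) ≡ e
  ν[p^e*w]≡e e {w} p∤w = ν-exact p^e*w≢0 (divides w (ℕP.*-comm (p ^ e) w))
    (λ p^1+e∣p^e*w → ℕP.<-irrefl refl (p^e∣p^v*w⇒e≤v {suc e} {e} p∤w p^1+e∣p^e*w))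
    where p^e*w≢0 : p ^ e * w ≢ 0
          p^e*w≢0 = ℕ.≢-nonZero⁻¹ _ {{ℕP.m*n≢0 (p ^ e) w {{ℕP.m^n≢0 p e}} {{ℕ.≢-nonZero (∤⇒≢0 p∤w)}}}}

  ∤⇒ν≡0 : ∀ {n} → ¬ p ∣ n → ν p n ≡ 0
  ∤⇒ν≡0 {n} p∤n = trans (cong (ν p) (sym (ℕP.*-identityˡ n))) (ν[p^e*w]≡e 0 p∤n)

  ν-mono-∣ : ∀ {d n} → n ≢ 0 → d ∣ n → ν p d ≤ ν p n
  ν-mono-∣ {d} n≢0 d∣n = p^e∣n⇒e≤ν n≢0 (∣-trans (p^ν∣n d) d∣n)

  ν-* : Prime p → ∀ {m n} → m ≢ 0 → n ≢ 0 → ν p (m * n) ≡ ν p m + ν p n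
  ν-* p-prime {m} {n} m≢0 n≢0 with ν-decomposition m≢0 | ν-decomposition n≢0
  ... | w , p∤w , m≡ | w′ , p∤w′ , n≡ = begin
    ν p (m * n)                                     ≡⟨ cong₂ (λ x y → ν p (x * y)) m≡ n≡ ⟩
    ν p (p ^ ν p m * w * (p ^ ν p n * w′))          ≡⟨ cong (ν p) (regroup (p ^ ν p m) w (p ^ ν p n) w′) ⟩
    ν p (p ^ ν p m * p ^ ν p n * (w * w′))          ≡⟨ cong (λ x → ν p (x * (w * w′))) (ℕP.^-distribˡ-+-* p (ν p m) (ν p n)) ⟨
    ν p (p ^ (ν p m + ν p n) * (w * w′))            ≡⟨ ν[p^e*w]≡e (ν p m + ν p n) p∤w*w′ ⟩
    ν p m + ν p n                                   ∎
    where
    open ≡-Reasoning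
    regroup : ∀ x y z t → x * y * (z * t) ≡ x * z * (y * t)
    regroup = ℕ-solve-∀
    p∤w*w′ : ¬ p ∣ w * w′
    p∤w*w′ p∣w*w′ with euclidsLemma w w′ p-prime p∣w*w′
    ... | inj₁ p∣w  = p∤w p∣w
    ... | inj₂ p∣w′ = p∤w′ p∣w′

  n!≢0 : ∀ n → n ! ≢ 0
  n!≢0 n = ℕ.≢-nonZero⁻¹ (n !) {{n ℕP.!≢0}}

  ν-!-mono : ∀ {m n} → m ≤ n → ν p (m !) ≤ ν p (n !)
  ν-!-mono {m} {n} m≤n = ν-mono-∣ (n!≢0 n) (m≤n⇒m!∣n! m≤n)

  ν-!-+ : Prime p → ∀ m n → ν p (m !) + ν p (n !) ≤ ν p ((m + n) !)
  ν-!-+ p-prime m n = begin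
    ν p (m !) + ν p (n !)   ≡⟨ ν-* p-prime (n!≢0 m) (n!≢0 n) ⟨
    ν p (m ! * n !)         ≤⟨ ν-mono-∣ (n!≢0 (m + n)) m!n!∣[m+n]! ⟩
    ν p ((m + n) !)         ∎
    where
    open ℕP.≤-Reasoning
    m!n!∣[m+n]! : m ! * n ! ∣ (m + n) !
    m!n!∣[m+n]! = subst (λ x → m ! * x ! ∣ (m + n) !) (ℕP.m+n∸m≡n m n) (k![n∸k]!∣n! (ℕP.m≤m+n m n))

  ∑ν!≤ν!∑ : Prime p → ∀ {k} (qs : Vec ℕ k) → sumℕ (vmap (λ q → ν p (q !)) qs) ≤ ν p (vsum qs !)
  ∑ν!≤ν!∑ p-prime []       = z≤n
  ∑ν!≤ν!∑ p-prime (q ∷ qs) =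
    ℕP.≤-trans (ℕP.+-monoʳ-≤ (ν p (q !)) (∑ν!≤ν!∑ p-prime qs)) (ν-!-+ p-prime q (vsum qs))

module StrongDivisibility (C : ℕ → ℤ) (sds : IsStrongDivSeq C) where
  open import Data.Nat.Divisibility using (_∣_; ∣-trans; ∣-refl; ∣-antisym; ∣⇒≤)
  open import Data.Nat.GCD using (gcd; gcd[m,n]∣m; gcd[m,n]∣n; gcd-greatest; gcd[m,n]≢0)
  import Data.Integer.Divisibility as ℤD
  import Data.Integer.GCD as ℤG

  C∣C : ∀ {i n} → 1 ≤ i → 1 ≤ n → i ∣ n → C i ℤD.∣ C n
  C∣C {i} {n} i≥1 n≥1 i∣n = subst (ℤD._∣ C n) gcd[Cn,Ci]≡Ci (ℤG.gcd[i,j]∣i (C n) (C i))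
    where gcd[Cn,Ci]≡Ci : ℤG.gcd (C n) (C i) ≡ C i
          gcd[Cn,Ci]≡Ci = trans (proj₂ sds n i n≥1 i≥1) (cong C (∣-antisym (gcd[m,n]∣n n i) (gcd-greatest i∣n ∣-refl)))

  rank∣⇒∣C : ∀ {m j n} → IsRankOfApparition C m j → 1 ≤ n → j ∣ n → ℤ.+ m ℤD.∣ C n
  rank∣⇒∣C (j≥1 , m∣Cj , _) n≥1 j∣n = ∣-trans m∣Cj (C∣C j≥1 n≥1 j∣n)

  ∣C⇒rank∣ : ∀ {m j n} → IsRankOfApparition C m j → 1 ≤ n → ℤ.+ m ℤD.∣ C n → j ∣ n
  ∣C⇒rank∣ {m} {j} {n} (j≥1 , m∣Cj , minimal) n≥1 m∣Cn = subst (_∣ n) g≡j (gcd[m,n]∣m n j)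
    where
    g = gcd n j
    g≥1 : 1 ≤ g
    g≥1 = ℕP.n≢0⇒n>0 (gcd[m,n]≢0 n j (inj₂ (ℕP.n>0⇒n≢0 j≥1)))
    m∣Cg : ℤ.+ m ℤD.∣ C g
    m∣Cg = subst (ℤ.+ m ℤD.∣_) (proj₂ sds n j n≥1 j≥1) (ℤG.gcd-greatest {C n} {C j} {ℤ.+ m} m∣Cn m∣Cj)
    g≡j : g ≡ j
    g≡j = ℕP.≤∧≮⇒≡ (∣⇒≤ {{ℕ.>-nonZero j≥1}} (gcd[m,n]∣n n j)) (λ g<j → minimal g g≥1 g<j m∣Cg)

module IdealPrime (C : ℕ → ℤ) (sds : IsStrongDivSeq C) (p : ℕ) (p-prime : Prime p)
                  (α : ℕ → ℕ) (s : ℕ) (ideal : IsIdealWith C p α s) where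
  open import Data.Nat using (_+_; _*_; _^_)
  open import Data.Nat.Primality using (prime⇒nonZero)
  open import Data.Nat.Divisibility using (_∣_; divides; *-cancelˡ-∣; ∣m+n∣m⇒∣n; ∣⇒≤)
  open import Data.Nat.DivMod using (_/_; _%_; m%n<n; m≡m%n+[m/n]*n)
  open StrongDivisibility C sds
  open Valuation p {{prime⇒nonTrivial p-prime}}

  private
    instance
      p≢0 : NonZero p
      p≢0 = prime⇒nonZero p-prime
    apparition = proj₁ ideal
    s≥1 = proj₁ (proj₂ ideal)
    constant = proj₁ (proj₂ (proj₂ ideal))
    growing = proj₂ (proj₂ (proj₂ ideal))

  a : ℕ
  a = α 1

  instance
    a≢0 : NonZero a
    a≢0 = ℕ.>-nonZero (proj₁ (apparition 1 ℕP.≤-refl))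

  α-below-s : ∀ e → 1 ≤ e → e ≤ s → α e ≡ a
  α-below-s (suc zero)    _ _   = refl
  α-below-s (suc (suc e)) _ e≤s =
    trans (constant (suc (suc e)) (s≤s (s≤s z≤n)) e≤s) (α-below-s (suc e) (s≤s z≤n) (ℕP.<⇒≤ e≤s))

  α-above-s : ∀ j → α (s + j) ≡ p ^ j * a
  α-above-s zero    = trans (cong α (ℕP.+-identityʳ s)) (trans (α-below-s s s≥1 ℕP.≤-refl) (sym (ℕP.*-identityˡ a)))
  α-above-s (suc j) = begin
    α (s + suc j)           ≡⟨ growing (s + suc j) (ℕP.m<m+n s (s≤s z≤n)) ⟩
    p * α (s + suc j ∸ 1)   ≡⟨ cong (λ e → p * α (e ∸ 1)) (ℕP.+-suc s j) ⟩
    p * α (s + j)           ≡⟨ cong (p *_) (α-above-s j) ⟩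
    p * (p ^ j * a)         ≡⟨ ℕP.*-assoc p (p ^ j) a ⟨
    p ^ suc j * a           ∎
    where open ≡-Reasoning

  ∣C∣≢0 : ∀ {m} → 1 ≤ m → ℤ.∣ C m ∣ ≢ 0
  ∣C∣≢0 {m} m≥1 ∣Cm∣≡0 = proj₁ sds m m≥1 (ℤP.∣i∣≡0⇒i≡0 ∣Cm∣≡0)

  ν-C-∤ : ∀ {m} → 1 ≤ m → ¬ a ∣ m → ν p ℤ.∣ C m ∣ ≡ 0
  ν-C-∤ {m} m≥1 a∤m = ∤⇒ν≡0 {ℤ.∣ C m ∣} (λ p∣Cm →
    a∤m (∣C⇒rank∣ (apparition 1 ℕP.≤-refl) m≥1 (subst (_∣ ℤ.∣ C m ∣) (sym (ℕP.*-identityʳ p)) p∣Cm)))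

  -- For k = p^v w with p ∤ w, α(p^(s+v)) = p^v a divides a k but α(p^(s+v+1)) = p^(v+1) a does not.
  ν-C-a* : ∀ {k} → 1 ≤ k → ν p ℤ.∣ C (a * k) ∣ ≡ s + ν p k
  ν-C-a* {k} k≥1 with ν-decomposition (ℕP.n>0⇒n≢0 k≥1)
  ... | w , p∤w , k≡p^v*w = ν-exact (∣C∣≢0 ak≥1) p^[s+v]∣Cak p^[s+v+1]∤Cak
    where
    v = ν p k
    ak≥1 : 1 ≤ a * k
    ak≥1 = ℕP.*-mono-≤ (proj₁ (apparition 1 ℕP.≤-refl)) k≥1
    ak≡ : a * k ≡ (p ^ v * a) * w
    ak≡ = trans (cong (a *_) k≡p^v*w) (regroup a (p ^ v) w)
      where regroup : ∀ x y z → x * (y * z) ≡ (y * x) * z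
            regroup = ℕ-solve-∀
    p^[s+v]∣Cak : p ^ (s + v) ∣ ℤ.∣ C (a * k) ∣
    p^[s+v]∣Cak = rank∣⇒∣C (apparition (s + v) (ℕP.≤-trans s≥1 (ℕP.m≤m+n s v))) ak≥1
      (divides w (trans ak≡ (trans (ℕP.*-comm _ w) (cong (w *_) (sym (α-above-s v))))))
    p^[s+v+1]∤Cak : ¬ p ^ suc (s + v) ∣ ℤ.∣ C (a * k) ∣
    p^[s+v+1]∤Cak p^[s+v+1]∣Cak = p∤w (*-cancelˡ-∣ (p ^ v * a) {{ℕP.m*n≢0 (p ^ v) a {{ℕP.m^n≢0 p v}}}} p^v*a*p∣p^v*a*w)
      where
      α[s+v+1]∣ak : α (suc (s + v)) ∣ a * k
      α[s+v+1]∣ak = ∣C⇒rank∣ (apparition (suc (s + v)) (s≤s z≤n)) ak≥1 p^[s+v+1]∣Cak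
      p^v*a*p∣p^v*a*w : p ^ v * a * p ∣ p ^ v * a * w
      p^v*a*p∣p^v*a*w = subst₂ _∣_ (trans (cong α (sym (ℕP.+-suc s v))) (trans (α-above-s (suc v)) (regroup p (p ^ v) a)))
                                   ak≡ α[s+v+1]∣ak
        where regroup : ∀ x y z → x * y * z ≡ y * z * x
              regroup = ℕ-solve-∀

  νcorial : ℕ → ℕ
  νcorial m = ν p ℤ.∣ corial C m ∣

  ∣corial∣≢0 : ∀ m → ℤ.∣ corial C m ∣ ≢ 0
  ∣corial∣≢0 zero    ()
  ∣corial∣≢0 (suc m) ∣C*corial∣≡0 with ℕP.m*n≡0⇒m≡0∨n≡0 _ (trans (sym (ℤP.abs-* (C (suc m)) (corial C m))) ∣C*corial∣≡0)
  ... | inj₁ ∣C∣≡0      = ∣C∣≢0 (s≤s z≤n) ∣C∣≡0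
  ... | inj₂ ∣corial∣≡0 = ∣corial∣≢0 m ∣corial∣≡0

  νcorial-suc : ∀ m → νcorial (suc m) ≡ ν p ℤ.∣ C (suc m) ∣ + νcorial m
  νcorial-suc m = trans (cong (ν p) (ℤP.abs-* (C (suc m)) (corial C m))) (ν-* p-prime (∣C∣≢0 (s≤s z≤n)) (∣corial∣≢0 m))

  νcorial-offset : ∀ q {t} → t < a → νcorial (a * q + t) ≡ νcorial (a * q)
  νcorial-offset q {zero}  _   = cong νcorial (ℕP.+-identityʳ (a * q))
  νcorial-offset q {suc t} t<a = begin
    νcorial (a * q + suc t)                         ≡⟨ cong νcorial (ℕP.+-suc (a * q) t) ⟩
    νcorial (suc (a * q + t))                       ≡⟨ νcorial-suc (a * q + t) ⟩
    ν p ℤ.∣ C (suc (a * q + t)) ∣ + νcorial (a * q + t)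
      ≡⟨ cong₂ _+_ (ν-C-∤ (s≤s z≤n) a∤) (νcorial-offset q (ℕP.<-trans (ℕP.n<1+n t) t<a)) ⟩
    νcorial (a * q)                                 ∎
    where
    open ≡-Reasoning
    a∤ : ¬ a ∣ suc (a * q + t)
    a∤ a∣ = ℕP.<⇒≱ t<a (∣⇒≤ (∣m+n∣m⇒∣n (subst (a ∣_) (sym (ℕP.+-suc (a * q) t)) a∣) (divides q (ℕP.*-comm a q))))

  νcorial-multiple : ∀ q → νcorial (a * q) ≡ s * q + ν p (q !)
  νcorial-multiple zero    rewrite ℕP.*-zeroʳ a | ℕP.*-zeroʳ s = refl
  νcorial-multiple (suc q) = begin
    νcorial (a * suc q)                              ≡⟨ cong νcorial (sym a*[1+q]≡) ⟩
    νcorial (suc (a * q + ℕ.pred a))                 ≡⟨ νcorial-suc (a * q + ℕ.pred a) ⟩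
    ν p ℤ.∣ C (suc (a * q + ℕ.pred a)) ∣ + νcorial (a * q + ℕ.pred a)
      ≡⟨ cong₂ _+_ (trans (cong (λ m → ν p ℤ.∣ C m ∣) a*[1+q]≡) (ν-C-a* (s≤s z≤n)))
                   (trans (νcorial-offset q (ℕP.≤-reflexive (ℕP.suc-pred a))) (νcorial-multiple q)) ⟩
    s + ν p (suc q) + (s * q + ν p (q !))             ≡⟨ regroup s (ν p (suc q)) q (ν p (q !)) ⟩
    s * suc q + (ν p (suc q) + ν p (q !))             ≡⟨ cong (s * suc q +_) (ν-* p-prime {suc q} (λ ()) (n!≢0 q)) ⟨
    s * suc q + ν p (suc q !)                         ∎
    where
    open ≡-Reasoning
    a*[1+q]≡ : suc (a * q + ℕ.pred a) ≡ a * suc q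
    a*[1+q]≡ = trans (cong suc (ℕP.+-comm (a * q) (ℕ.pred a)))
                     (trans (cong (_+ a * q) (ℕP.suc-pred a)) (sym (ℕP.*-suc a q)))
    regroup : ∀ x y z w → x + y + (x * z + w) ≡ x * suc z + (y + w)
    regroup = ℕ-solve-∀

  ν-corial : ∀ m → νcorial m ≡ s * (m / a) + ν p ((m / a) !)
  ν-corial m = begin
    νcorial m                          ≡⟨ cong νcorial m≡ ⟩
    νcorial (a * (m / a) + m % a)      ≡⟨ νcorial-offset (m / a) (m%n<n m a) ⟩
    νcorial (a * (m / a))              ≡⟨ νcorial-multiple (m / a) ⟩
    s * (m / a) + ν p ((m / a) !)      ∎
    where
    open ≡-Reasoning
    m≡ : m ≡ a * (m / a) + m % a
    m≡ = trans (m≡m%n+[m/n]*n m a) (trans (ℕP.+-comm (m % a) _) (cong (_+ m % a) (ℕP.*-comm (m / a) a)))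

Tλ-≤ : ∀ p k l n x → l ≤ n → Tλ p k l n x ≡ x ℤ.^ ((ν p (n !) ∸ ν p ((n ∸ l) !)) ℕ.+ l) ℤ.* T p k (n ∸ l) x
Tλ-≤ p k l n x l≤n with l ℕ.≤? n
... | yes _   = refl
... | no  l≰n = contradiction l≤n l≰n

Tλ-> : ∀ p k l n x → n < l → Tλ p k l n x ≡ 0ℤ
Tλ-> p k l n x n<l with l ℕ.≤? n
... | yes l≤n = contradiction l≤n (ℕP.<⇒≱ n<l)
... | no  _   = refl

module Expansion (C : ℕ → ℤ) (sds : IsStrongDivSeq C) (p : ℕ) (p-prime : Prime p)
                 (α : ℕ → ℕ) (s : ℕ) (ideal : IsIdealWith C p α s) where
  open import Data.Nat using (_+_; _*_)
  open import Data.Integer using () renaming (_*_ to _⊛_)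
  open import Data.Nat.DivMod using (_/_)
  open IdealPrime C sds p p-prime α s ideal public using (a; a≢0)
  open IdealPrime C sds p p-prime α s ideal using (ν-corial)
  open Valuation p {{prime⇒nonTrivial p-prime}} using (ν-!-mono; ∑ν!≤ν!∑)
  open FiniteSums
  open CompositionSums
  open BoundedCompositionCounts a
  open QuotientDecomposition a public using (quotients; multiplicity; ∑ᶜ-quotients)
  open QuotientDecomposition a using ([a*q+t]/a≡q)
  open CompositionCounts using (alternatingBinom)
  open import Data.Nat.Combinatorics using () renaming (_C_ to binom)

  -- ν_p (m !_C) for any m with ⌊m / a⌋ = q
  νcorialOfQuotient : ℕ → ℕ
  νcorialOfQuotient q = s * q + ν p (q !)

  quotientWeight : ℤ → ℕ → ∀ {k} → Vec ℕ k → ℤ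
  quotientWeight x N qs = x ℤ.^ (νcorialOfQuotient N ∸ sumℕ (vmap νcorialOfQuotient qs))

  νMultiC≡ : ∀ {k} (ms : Vec ℕ k) →
    νMultiC C p ms ≡ νcorialOfQuotient (vsum ms / a) ∸ sumℕ (vmap νcorialOfQuotient (quotients ms))
  νMultiC≡ ms = cong₂ _∸_ (ν-corial (vsum ms)) (∑ν-corial ms)
    where
    ∑ν-corial : ∀ {k} (ms : Vec ℕ k) →
      sumℕ (vmap (λ m → νℤ p (corial C m)) ms) ≡ sumℕ (vmap νcorialOfQuotient (quotients ms))
    ∑ν-corial []       = refl
    ∑ν-corial (m ∷ ms) = cong₂ _+_ (ν-corial m) (∑ν-corial ms)

  LHS≡∑ᶜ-quotientWeight : ∀ k {n n′ r} x → r < a → n ≡ a * n′ + r →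
    LHS C p k n x ≡ ∑ᶜ k n (quotientWeight x n′ ∘ quotients)
  LHS≡∑ᶜ-quotientWeight k {n} {n′} x r<a n≡ = ∑ᶜ-cong k n λ ms tot≡n →
    cong (x ℤ.^_) (trans (νMultiC≡ ms)
      (cong (λ q → νcorialOfQuotient q ∸ sumℕ (vmap νcorialOfQuotient (quotients ms)))
            (trans (cong (_/ a) (trans tot≡n n≡)) ([a*q+t]/a≡q n′ r<a))))

  ∑νcorialOfQuotient : ∀ {k} (qs : Vec ℕ k) →
    sumℕ (vmap νcorialOfQuotient qs) ≡ s * vsum qs + sumℕ (vmap (λ q → ν p (q !)) qs)
  ∑νcorialOfQuotient []       = cong (_+ 0) (sym (ℕP.*-zeroʳ s))
  ∑νcorialOfQuotient (q ∷ qs) rewrite ∑νcorialOfQuotient qs =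
    regroup s q (ν p (q !)) (vsum qs) (sumℕ (vmap (λ q → ν p (q !)) qs))
    where regroup : ∀ s q v Q D → s * q + v + (s * Q + D) ≡ s * (q + Q) + (v + D)
          regroup = ℕ-solve-∀

  ∸-regroup : ∀ s Q l {A B D} → 1 ≤ s → D ≤ B → B ≤ A →
    (s * (Q + l) + A) ∸ (s * Q + D) ≡ (s ∸ 1) * l + ((A ∸ B + l) + (B ∸ D))
  ∸-regroup (suc s′) Q l {A} {B} {D} _ D≤B B≤A = begin
    (suc s′ * (Q + l) + A) ∸ (suc s′ * Q + D)
      ≡⟨ cong (λ A → (suc s′ * (Q + l) + A) ∸ (suc s′ * Q + D)) A≡ ⟩
    (suc s′ * (Q + l) + (D + (B ∸ D) + (A ∸ B))) ∸ (suc s′ * Q + D)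
      ≡⟨ cong (_∸ (suc s′ * Q + D)) (regroup₁ s′ Q l D (B ∸ D) (A ∸ B)) ⟩
    (suc s′ * Q + D) + (s′ * l + ((A ∸ B + l) + (B ∸ D))) ∸ (suc s′ * Q + D)
      ≡⟨ ℕP.m+n∸m≡n (suc s′ * Q + D) _ ⟩
    s′ * l + ((A ∸ B + l) + (B ∸ D)) ∎
    where
    open ≡-Reasoning
    A≡ : A ≡ D + (B ∸ D) + (A ∸ B)
    A≡ = trans (sym (ℕP.m+[n∸m]≡n B≤A)) (cong (_+ (A ∸ B)) (sym (ℕP.m+[n∸m]≡n D≤B)))
    regroup₁ : ∀ s′ Q l D B′ A′ →
      suc s′ * (Q + l) + (D + B′ + A′) ≡ (suc s′ * Q + D) + (s′ * l + ((A′ + l) + B′))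
    regroup₁ = ℕ-solve-∀

  quotientWeight-exponent : ∀ N l {k} (qs : Vec ℕ k) → l ≤ N → vsum qs ≡ N ∸ l →
    νcorialOfQuotient N ∸ sumℕ (vmap νcorialOfQuotient qs) ≡
    (s ∸ 1) * l + ((ν p (N !) ∸ ν p ((N ∸ l) !) + l) + νMulti p qs)
  quotientWeight-exponent N l qs l≤N tot≡ = begin
    (s * N + ν p (N !)) ∸ sumℕ (vmap νcorialOfQuotient qs)
      ≡⟨ cong₂ (λ M S → (s * M + ν p (N !)) ∸ S) (sym (ℕP.m∸n+n≡m l≤N))
               (trans (∑νcorialOfQuotient qs) (cong (λ Q → s * Q + D) tot≡)) ⟩
    (s * (N ∸ l + l) + ν p (N !)) ∸ (s * (N ∸ l) + D)
      ≡⟨ ∸-regroup s (N ∸ l) l (proj₁ (proj₂ ideal)) (subst (λ Q → D ≤ ν p (Q !)) tot≡ (∑ν!≤ν!∑ p-prime qs))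
                   (ν-!-mono (ℕP.m∸n≤m N l)) ⟩
    (s ∸ 1) * l + ((ν p (N !) ∸ ν p ((N ∸ l) !) + l) + (ν p ((N ∸ l) !) ∸ D))
      ≡⟨ cong (λ Q → (s ∸ 1) * l + ((ν p (N !) ∸ ν p ((N ∸ l) !) + l) + (ν p (Q !) ∸ D))) tot≡ ⟨
    (s ∸ 1) * l + ((ν p (N !) ∸ ν p ((N ∸ l) !) + l) + νMulti p qs) ∎
    where
    open ≡-Reasoning
    D = sumℕ (vmap (λ q → ν p (q !)) qs)

  ∑ᶜ-quotientWeight : ∀ k N l x → l ≤ N →
    ∑ᶜ k (N ∸ l) (quotientWeight x N) ≡
    x ℤ.^ ((s ∸ 1) * l) ⊛ (x ℤ.^ ((ν p (N !) ∸ ν p ((N ∸ l) !)) + l) ⊛ T p k (N ∸ l) x)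
  ∑ᶜ-quotientWeight k N l x l≤N = begin
    ∑ᶜ k (N ∸ l) (quotientWeight x N)
      ≡⟨ ∑ᶜ-cong k (N ∸ l) (λ qs tot≡ → trans (cong (x ℤ.^_) (quotientWeight-exponent N l qs l≤N tot≡)) (split qs)) ⟩
    ∑ᶜ k (N ∸ l) (λ qs → x ℤ.^ e₁ ⊛ (x ℤ.^ e₂ ⊛ x ℤ.^ νMulti p qs))
      ≡⟨ *-distribˡ-∑ᶜ k (N ∸ l) (x ℤ.^ e₁) (λ qs → x ℤ.^ e₂ ⊛ x ℤ.^ νMulti p qs) ⟨
    x ℤ.^ e₁ ⊛ ∑ᶜ k (N ∸ l) (λ qs → x ℤ.^ e₂ ⊛ x ℤ.^ νMulti p qs)
      ≡⟨ cong (x ℤ.^ e₁ ⊛_) (*-distribˡ-∑ᶜ k (N ∸ l) (x ℤ.^ e₂) (λ qs → x ℤ.^ νMulti p qs)) ⟨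
    x ℤ.^ e₁ ⊛ (x ℤ.^ e₂ ⊛ T p k (N ∸ l) x) ∎
    where
    open ≡-Reasoning
    e₁ = (s ∸ 1) * l
    e₂ = (ν p (N !) ∸ ν p ((N ∸ l) !)) + l
    split : ∀ qs → x ℤ.^ (e₁ + (e₂ + νMulti p qs)) ≡ x ℤ.^ e₁ ⊛ (x ℤ.^ e₂ ⊛ x ℤ.^ νMulti p qs)
    split qs = trans (ℤP.^-distribˡ-+-* x e₁ _) (cong (x ℤ.^ e₁ ⊛_) (ℤP.^-distribˡ-+-* x e₂ (νMulti p qs)))

  module Terms {n n′ r : ℕ} (r<a : r < a) (n≡ : n ≡ a * n′ + r) (k : ℕ) (x : ℤ) where

    term : ℕ → ℤ
    term Q = multiplicity (suc k) n Q ⊛ ∑ᶜ (suc k) Q (quotientWeight x n′)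

    ∑-term-truncate : ∑[ Q < suc n ] term Q ≡ ∑[ Q < suc n′ ] term Q
    ∑-term-truncate = ∑-truncate term (s≤s n′≤n) (λ Q n′<Q _ →
      trans (cong (_⊛ ∑ᶜ (suc k) Q (quotientWeight x n′)) (⟪⊖⟫-> (boundedCompositionCount (suc k)) (n<a*Q n′<Q)))
            (ℤP.*-zeroˡ (∑ᶜ (suc k) Q (quotientWeight x n′))))
      where
      n′≤n : n′ ≤ n
      n′≤n = ℕP.≤-trans (ℕP.m≤n*m n′ a) (subst (a * n′ ≤_) (sym n≡) (ℕP.m≤m+n (a * n′) r))
      n<a*Q : ∀ {Q} → n′ < Q → n < a * Q
      n<a*Q {Q} n′<Q = begin-strict
        n              ≡⟨ n≡ ⟩
        a * n′ + r     <⟨ ℕP.+-monoʳ-< (a * n′) r<a ⟩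
        a * n′ + a     ≡⟨ trans (ℕP.+-comm (a * n′) a) (sym (ℕP.*-suc a n′)) ⟩
        a * suc n′     ≤⟨ ℕP.*-monoʳ-≤ a n′<Q ⟩
        a * Q          ∎
        where open ℕP.≤-Reasoning

    multiplicity-reversed : ∀ {l} → l ≤ n′ → multiplicity (suc k) n (n′ ∸ l) ≡ boundedCompositionCount (suc k) (r + a * l)
    multiplicity-reversed {l} l≤n′ = begin
      N ⟪ n ⊖ a * (n′ ∸ l) ⟫                          ≡⟨ ⟪⊖⟫-≤ N (subst (a * (n′ ∸ l) ≤_) (sym n≡′) (ℕP.m≤m+n _ _)) ⟩
      N (n ∸ a * (n′ ∸ l))                            ≡⟨ cong (λ m → N (m ∸ a * (n′ ∸ l))) n≡′ ⟩
      N (a * (n′ ∸ l) + (r + a * l) ∸ a * (n′ ∸ l))   ≡⟨ cong N (ℕP.m+n∸m≡n (a * (n′ ∸ l)) (r + a * l)) ⟩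
      N (r + a * l)                                   ∎
      where
      open ≡-Reasoning
      N = boundedCompositionCount (suc k)
      regroup : ∀ a Q l r → a * (Q + l) + r ≡ a * Q + (r + a * l)
      regroup = ℕ-solve-∀
      n≡′ : n ≡ a * (n′ ∸ l) + (r + a * l)
      n≡′ = trans n≡ (trans (cong (λ m → a * m + r) (sym (ℕP.m∸n+n≡m l≤n′))) (regroup a (n′ ∸ l) l r))

    u≡ : ∀ l → u a s (suc k) l r x ≡ x ℤ.^ ((s ∸ 1) * l) ⊛ boundedCompositionCount (suc k) (r + a * l)
    u≡ l = cong (x ℤ.^ ((s ∸ 1) * l) ⊛_) (begin
      sumℤ (map (λ j → alternatingBinom (suc k) j ⊛ ℤ.+ binom (r + (l ∸ j) * a + suc k ∸ 1) k) (upTo (suc l)))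
        ≡⟨ sum-upTo (suc l) _ ⟩
      ∑[ j < suc l ] (alternatingBinom (suc k) j ⊛ ℤ.+ binom (r + (l ∸ j) * a + suc k ∸ 1) k)
        ≡⟨ ∑-cong (suc l) (λ j _ → cong (λ m → alternatingBinom (suc k) j ⊛ ℤ.+ binom (m ∸ 1) k)
                                       (ℕP.+-suc (r + (l ∸ j) * a) k)) ⟩
      ∑[ j < suc l ] (alternatingBinom (suc k) j ⊛ ℤ.+ binom (r + (l ∸ j) * a + k) k)
        ≡⟨ boundedCompositionCount-formula k r l r<a ⟨
      boundedCompositionCount (suc k) (r + a * l) ∎)
      where open ≡-Reasoning

    term-reversed : ∀ {l} → l ≤ n′ → term (n′ ∸ l) ≡ u a s (suc k) l r x ⊛ Tλ p (suc k) l n′ x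
    term-reversed {l} l≤n′ = begin
      term (n′ ∸ l)
        ≡⟨ cong₂ _⊛_ (multiplicity-reversed l≤n′) (∑ᶜ-quotientWeight (suc k) n′ l x l≤n′) ⟩
      N ⊛ (x ℤ.^ e₁ ⊛ (x ℤ.^ e₂ ⊛ T p (suc k) (n′ ∸ l) x))
        ≡⟨ regroup N (x ℤ.^ e₁) (x ℤ.^ e₂ ⊛ T p (suc k) (n′ ∸ l) x) ⟩
      x ℤ.^ e₁ ⊛ N ⊛ (x ℤ.^ e₂ ⊛ T p (suc k) (n′ ∸ l) x)
        ≡⟨ cong₂ _⊛_ (u≡ l) (Tλ-≤ p (suc k) l n′ x l≤n′) ⟨
      u a s (suc k) l r x ⊛ Tλ p (suc k) l n′ x ∎
      where
      open ≡-Reasoning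
      N = boundedCompositionCount (suc k) (r + a * l)
      e₁ = (s ∸ 1) * l
      e₂ = (ν p (n′ !) ∸ ν p ((n′ ∸ l) !)) + l
      regroup : ∀ x y z → x ⊛ (y ⊛ z) ≡ y ⊛ x ⊛ z
      regroup = solve-∀

    [k+1]*[a-1]<r+a*l : ∀ {l} → suc k ≤ l → suc k * (a ∸ 1) < r + a * l
    [k+1]*[a-1]<r+a*l {l} k<l = begin-strict
      suc k * (a ∸ 1) <⟨ ℕP.*-monoʳ-< (suc k) (ℕP.≤-reflexive (ℕP.suc-pred a)) ⟩
      suc k * a       ≤⟨ ℕP.*-monoˡ-≤ a k<l ⟩
      l * a           ≡⟨ ℕP.*-comm l a ⟩
      a * l           ≤⟨ ℕP.m≤n+m (a * l) r ⟩
      r + a * l       ∎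
      where open ℕP.≤-Reasoning

    term-reversed-vanish : ∀ {l} → suc k ≤ l → l ≤ n′ → term (n′ ∸ l) ≡ 0ℤ
    term-reversed-vanish {l} k<l l≤n′ = begin
      term (n′ ∸ l)                                       ≡⟨ cong (_⊛ weight) (multiplicity-reversed l≤n′) ⟩
      boundedCompositionCount (suc k) (r + a * l) ⊛ weight
        ≡⟨ cong (_⊛ weight) (boundedCompositionCount-vanish (suc k) (r + a * l) ([k+1]*[a-1]<r+a*l k<l)) ⟩
      0ℤ ⊛ weight                                         ≡⟨ ℤP.*-zeroˡ weight ⟩
      0ℤ                                                  ∎
      where
      open ≡-Reasoning
      weight = ∑ᶜ (suc k) (n′ ∸ l) (quotientWeight x n′)

    ∑-term-reversed : ∑[ l < suc n′ ] term (n′ ∸ l) ≡ ∑[ l < suc k ] (u a s (suc k) l r x ⊛ Tλ p (suc k) l n′ x)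
    ∑-term-reversed = ∑-cong-support (suc n′) (suc k)
      (λ l k<l l≤n′ → term-reversed-vanish k<l (ℕP.≤-pred l≤n′))
      (λ l n′<l _ → trans (cong (u a s (suc k) l r x ⊛_) (Tλ-> p (suc k) l n′ x n′<l)) (ℤP.*-zeroʳ (u a s (suc k) l r x)))
      (λ l l≤n′ _ → term-reversed (ℕP.≤-pred l≤n′))

lemma3p3 : (C : ℕ → ℤ) → IsStrongDivSeq C →
    (p : ℕ) → Prime p → (α : ℕ → ℕ) → (s : ℕ) → IsIdealWith C p α s →
    (k : ℕ) → 2 ≤ k →
    (n n′ r : ℕ) → r < α 1 → n ≡ α 1 ℕ.* n′ ℕ.+ r →
    (x : ℤ) →
    LHS C p k n x ≡
      sumℤ (map (λ l → u (α 1) s k l r x ℤ.* Tλ p k l n′ x) (upTo k))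
lemma3p3 C sds p p-prime α s ideal zero () n
lemma3p3 C sds p p-prime α s ideal (suc k) _ n n′ r r<a n≡ x = begin
  LHS C p (suc k) n x                             ≡⟨ LHS≡∑ᶜ-quotientWeight (suc k) x r<a n≡ ⟩
  ∑ᶜ (suc k) n (quotientWeight x n′ ∘ quotients) ≡⟨ ∑ᶜ-quotients (suc k) n (quotientWeight x n′) ⟩
  ∑[ Q < suc n ] term Q                           ≡⟨ ∑-term-truncate ⟩
  ∑[ Q < suc n′ ] term Q                          ≡⟨ ∑-reverse (suc n′) term ⟩
  ∑[ l < suc n′ ] term (n′ ∸ l)                   ≡⟨ ∑-term-reversed ⟩
  ∑[ l < suc k ] (u a s (suc k) l r x ℤ.* Tλ p (suc k) l n′ x)
    ≡⟨ sum-upTo (suc k) _ ⟨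
  sumℤ (map (λ l → u a s (suc k) l r x ℤ.* Tλ p (suc k) l n′ x) (upTo (suc k))) ∎
  where
  open ≡-Reasoning
  open FiniteSums
  open CompositionSums
  open Expansion C sds p p-prime α s ideal
  open Terms r<a n≡ k x
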